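{- Let $n \geq 4$ and let $(u,v)$ be an edge of $S_n^2$. For $q \in [n]$ let $W_q$ be the set of vertices of $S_n^2$ whose first symbol is $q$. Then for every $q \in [n]$ there exist two distinct edges $(w_q^k, z_q^k)$, $k \in \{1,2\}$, with $w_q^k \in W_q$ and $z_q^k = w_q^k s_n^+$, such that for each $k \in \{1,2\}$ there is a Hamiltonian cycle of $S_n^2$ containing both $(u,v)$ and $(w_q^k, z_q^k)$.
   Context: For $n \geq 3$, the split-star network $S_n^2$ is the graph whose vertex set is the set of all permutations of $[n]$, written as strings $x_1x_2\cdots x_n$. For a vertex $u = x_1\cdots x_n$: $u\circ(1,2)$ is the vertex $y_1\cdots y_n$ with $y_1=x_2$, $y_2=x_1$, $y_j=x_j$ for $j\in[3,n]$; for $k \in [3,n]$, $us_k^-$ is the vertex with $y_1 = x_2$, $y_2 = x_k$, $y_k = x_1$, $y_j = x_j$ for $j\in[3,n]\setminus\{k\}$; and $us_k^+$ is the vertex with $y_1 = x_k$, $y_2 = x_1$, $y_k = x_2$, $y_j = x_j$ for $j\in[3,n]\setminus\{k\}$. The edges of $S_n^2$ are exactly the pairs $\{u, u\circ(1,2)\}$, $\{u, us_k^-\}$, $\{u, us_k^+\}$ for $u$ a vertex and $k \in [3,n]$. -}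

module Defs where

open import Data.Nat using (ℕ; suc; _≤_)
open import Data.Fin using (Fin; fromℕ)
open import Data.Vec using (Vec; _∷_; lookup; _[_]≔_; toList; head)
open import Data.List using (List; []; _∷_; _++_; zip; length)
open import Data.List.Relation.Unary.Unique.Propositional using (Unique)
open import Data.List.Relation.Unary.All using (All)
open import Data.List.Membership.Propositional using (_∈_)
open import Data.Product using (Σ; ∃; _×_; _,_; proj₁; proj₂)
open import Data.Sum using (_⊎_)
open import Relation.Binary.PropositionalEquality using (_≡_)

-- Convention: symbols [n] are Fin n (symbol i+1 is represented by i);
-- positions 1..n of a string are the n entries of a Vec.
-- We parametrise by m with n = m + 3, i.e. N m = suc (suc (suc m)).

N : ℕ → ℕ
N m = suc (suc (suc m))

Str : ℕ → Set
Str m = Vec (Fin (N m)) (N m)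

IsPerm : ∀ {m} → Str m → Set
IsPerm v = Unique (toList v)

swap12 : ∀ {A : Set} {k} → Vec A (suc (suc k)) → Vec A (suc (suc k))
swap12 (x ∷ y ∷ r) = y ∷ x ∷ r

-- u s_k^- with position k = j + 3  (j : Fin (n-2) indexes the tail x3..xn)
sMinus : ∀ {A : Set} {k} → Fin k → Vec A (suc (suc k)) → Vec A (suc (suc k))
sMinus j (x ∷ y ∷ r) = y ∷ lookup r j ∷ (r [ j ]≔ x)

-- u s_k^+ with position k = j + 3
sPlus : ∀ {A : Set} {k} → Fin k → Vec A (suc (suc k)) → Vec A (suc (suc k))
sPlus j (x ∷ y ∷ r) = lookup r j ∷ x ∷ (r [ j ]≔ y)

sPlusLast : ∀ {m} → Str m → Str m
sPlusLast {m} = sPlus (fromℕ m)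

Gen : ∀ {m} → Str m → Str m → Set
Gen {m} u v = (v ≡ swap12 u)
            ⊎ (∃ λ (j : Fin (suc m)) → v ≡ sMinus j u)
            ⊎ (∃ λ (j : Fin (suc m)) → v ≡ sPlus j u)

Edge : ∀ {m} → Str m → Str m → Set
Edge u v = IsPerm u × IsPerm v × (Gen u v ⊎ Gen v u)

cycPairs : ∀ {A : Set} → List A → List (A × A)
cycPairs [] = []
cycPairs (x ∷ xs) = zip (x ∷ xs) (xs ++ (x ∷ []))

record HamCycle (m : ℕ) : Set where
  field
    cyc       : List (Str m)
    distinct  : Unique cyc
    onlyPerms : All IsPerm cyc
    covers    : ∀ (v : Str m) → IsPerm v → v ∈ cyc
    long      : 3 ≤ length cyc
    adjacent  : All (λ p → Edge (proj₁ p) (proj₂ p)) (cycPairs cyc)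

Contains : ∀ {m} → HamCycle m → Str m → Str m → Set
Contains H u v = ((u , v) ∈ cycPairs (HamCycle.cyc H)) ⊎ ((v , u) ∈ cycPairs (HamCycle.cyc H))

-- Fixing the symbol at the last position splits S_n^2 into n copies of S_{n-1}^2, and the
-- edges u s_n^± join every copy to every other one.  By induction on n, starting from the
-- prism S_3^2, every S_n^2 is Hamiltonian connected, even when built on an arbitrary symbol
-- set: a Hamiltonian path may pass through the copies in any order, covering each copy by a
-- Hamiltonian path of it between the entry and exit vertices.
--
-- A Hamiltonian cycle through the edge {u, v} is a Hamiltonian path from v to u.  If u and v
-- lie in different copies, the path runs through the copies from that of v to that of u;
-- otherwise it leaves the common copy right after v and re-enters it at the successor v″ of v
-- on a Hamiltonian path of that copy.  Either way one link edge of the route can be taken to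
-- be an edge {w, w s_n^+} with w starting with q, and prescribing in two ways which copies it
-- joins gives the two edges.  The available prescriptions depend on where q occurs in u, v
-- and v″; for n = 4 the case u = v∘(1,2) with q at position 3 needs a special Hamiltonian
-- path of S_3^2.

module Submission where

open import Defs
open import Data.Nat using (ℕ; zero; suc; _≤_; _<_; s≤s; z≤n)
open import Data.Nat.Properties using (≤-pred; ≤-refl; m≤m+n)
import Data.Fin as Fin
open import Data.Fin using (Fin; zero; suc; punchIn; punchOut; fromℕ)
open import Data.Fin.Patterns using (0F; 1F; 2F; 3F; 4F; 5F)
open import Data.Fin.Properties using (all?; any?; pigeonhole; punchOut-injective; <⇒≢)
import Data.Vec as Vec
open import Data.Vec using (Vec; []; _∷_; head; lookup; _[_]≔_; toList; insertAt; removeAt)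
open import Data.Vec.Properties
  using (insertAt-removeAt; removeAt-insertAt; insertAt-lookup; insertAt-punchIn; lookup-map; toList-map;
         lookup∘update; lookup∘update′; ≡-dec; ∷-injective; length-toList)
open import Data.Vec.Membership.Propositional.Properties using (∈-lookup; ∈-toList⁺)
import Data.List as List
open import Data.List using (List; []; _∷_; _++_; length; reverse; zip)
open import Data.List.Properties using (++-assoc; length-++; reverse-++; unfold-reverse)
open import Data.List.Relation.Unary.All as All using (All; []; _∷_)
import Data.List.Relation.Unary.All.Properties as All
open import Data.List.Relation.Unary.Any using (here; there)
open import Data.List.Relation.Unary.Unique.Propositional
  using (Unique; []; _∷_) renaming (head to Unique-head; tail to Unique-tail)
import Data.List.Relation.Unary.Unique.Propositional.Properties as Unique
open import Data.List.Relation.Unary.Unique.Propositional.Properties using (Unique[x∷xs]⇒x∉xs)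
open import Data.List.Membership.Propositional using (_∈_; _∉_)
open import Data.List.Relation.Binary.Disjoint.Propositional using (Disjoint)
open import Data.List.Membership.Propositional.Properties
  using (∈-∃++; ∈-++⁺ˡ; ∈-++⁺ʳ; ∈-++⁻; ∈-map⁺; ∈-map⁻)
open import Data.List.Relation.Binary.Permutation.Propositional
  using (_↭_; refl; prep; swap; ↭-sym; ↭-trans; ↭⇒↭ₛ)
open import Data.List.Relation.Binary.Permutation.Propositional.Properties
  using (∈-resp-↭; All-resp-↭; shift; ↭-length; ↭-reverse; ++⁺ˡ)
import Data.List.Relation.Binary.Permutation.Setoid.Properties as Permutationₛ
open import Data.Product using (Σ; ∃; ∃₂; _×_; _,_; proj₁; proj₂; map₂)
open import Data.Sum using (_⊎_; inj₁; inj₂)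
open import Data.Empty using (⊥; ⊥-elim)
open import Relation.Nullary using (¬_; yes; no; ¬?)
open import Relation.Nullary.Decidable using (True; toWitness; from-yes; _→-dec_; _×-dec_)
open import Function using (_∘_; flip; case_of_)
open import Relation.Binary.Definitions using (DecidableEquality)
open import Relation.Unary using (Decidable; U)
open import Data.Unit using (tt)
open import Relation.Binary.PropositionalEquality
  using (_≡_; _≢_; refl; sym; trans; cong; cong₂; subst; subst₂; setoid; module ≡-Reasoning)

module _ {A : Set} where

  Unique-resp-↭ : ∀ {xs ys : List A} → xs ↭ ys → Unique xs → Unique ys
  Unique-resp-↭ p = Permutationₛ.Unique-resp-↭ (setoid A) (↭⇒↭ₛ p)

  ∈⇒↭∷ : ∀ {x : A} {xs} → x ∈ xs → ∃ λ ys → xs ↭ x ∷ ys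
  ∈⇒↭∷ {x} x∈xs with ys , zs , refl ← ∈-∃++ x∈xs = ys ++ zs , shift x ys zs

  ∈-↭∷-≢ : ∀ {x y : A} {xs ys} → xs ↭ x ∷ ys → y ∈ xs → y ≢ x → y ∈ ys
  ∈-↭∷-≢ p y∈xs y≢x with ∈-resp-↭ p y∈xs
  ... | here y≡x = ⊥-elim (y≢x y≡x)
  ... | there y∈ys = y∈ys

  ⊆⇒++-↭ : ∀ {E xs : List A} → Unique E → All (_∈ xs) E → ∃ λ D → E ++ D ↭ xs
  ⊆⇒++-↭ {[]} {xs} _ _ = xs , refl
  ⊆⇒++-↭ {e ∷ E} (e∉E ∷ uE) (e∈xs ∷ E⊆xs) with ys , xs↭e∷ys ← ∈⇒↭∷ e∈xs =
    let E⊆ys = All.zipWith (λ (x∈xs , e≢x) → ∈-↭∷-≢ xs↭e∷ys x∈xs (e≢x ∘ sym)) (E⊆xs , e∉E)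
        D , E++D↭ys = ⊆⇒++-↭ uE E⊆ys
    in D , ↭-trans (prep e E++D↭ys) (↭-sym xs↭e∷ys)

  Unique-⊆⇒length-≤ : ∀ {E xs : List A} → Unique E → All (_∈ xs) E → length E ≤ length xs
  Unique-⊆⇒length-≤ {E} uE E⊆xs with D , E++D↭xs ← ⊆⇒++-↭ uE E⊆xs =
    subst (length E ≤_) (trans (sym (length-++ E)) (↭-length E++D↭xs)) (m≤m+n (length E) (length D))

  Unique-++⁻ : ∀ xs {ys : List A} → Unique (xs ++ ys) → Unique ys × Disjoint xs ys
  Unique-++⁻ [] u = u , λ ()
  Unique-++⁻ (x ∷ xs) (x∉ ∷ u) with uys , xs#ys ← Unique-++⁻ xs u = uys , λ where
    (here refl , v∈ys) → All.lookup x∉ (∈-++⁺ʳ xs v∈ys) refl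
    (there v∈xs , v∈ys) → xs#ys (v∈xs , v∈ys)

  distinct₃ : ∀ {a b c : A} → a ≢ b → a ≢ c → b ≢ c → Unique (a ∷ b ∷ c ∷ [])
  distinct₃ a≢b a≢c b≢c = (a≢b ∷ a≢c ∷ []) ∷ (b≢c ∷ []) ∷ [] ∷ []

  distinct₄ : ∀ {a b c d : A} → a ≢ b → a ≢ c → a ≢ d → b ≢ c → b ≢ d → c ≢ d →
    Unique (a ∷ b ∷ c ∷ d ∷ [])
  distinct₄ a≢b a≢c a≢d b≢c b≢d c≢d = (a≢b ∷ a≢c ∷ a≢d ∷ []) ∷ distinct₃ b≢c b≢d c≢d

  ∉⇒≢ : ∀ {s : A} {E} → s ∉ E → ∀ {t} → t ∈ E → t ≢ s
  ∉⇒≢ s∉E t∈E refl = s∉E t∈E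

  flip₃ : ∀ B {a b c : A} → Unique (B ++ a ∷ b ∷ c ∷ []) → Unique (B ++ c ∷ b ∷ a ∷ [])
  flip₃ B = Unique-resp-↭ (++⁺ˡ B (↭-sym (↭-reverse _)))

  module _ (_≟_ : DecidableEquality A) where

    open import Data.List.Membership.DecPropositional _≟_ using (_∈?_)

    ∃∉-shorter : ∀ {xs : List A} → Unique xs → (E : List A) → length E < length xs →
      ∃ λ s → s ∈ xs × s ∉ E
    ∃∉-shorter {x ∷ xs} (x∉xs ∷ u) E |E|<|xs| with x ∈? E
    ... | no x∉E = x , here refl , x∉E
    ... | yes x∈E with E′ , E↭ ← ∈⇒↭∷ x∈E
                  with s , s∈xs , s∉E′ ← ∃∉-shorter u E′ (≤-pred (subst (_< _) (↭-length E↭) |E|<|xs|)) =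
      s , there s∈xs , λ s∈E → s∉E′ (∈-↭∷-≢ E↭ s∈E λ s≡x → All.lookup x∉xs s∈xs (sym s≡x))

module _ {A : Set} where

  insertAt-↭ : ∀ {n} (r : Vec A n) (j : Fin (suc n)) (c : A) → toList (insertAt r j c) ↭ c ∷ toList r
  insertAt-↭ r zero c = refl
  insertAt-↭ (x ∷ r) (suc j) c = ↭-trans (prep x (insertAt-↭ r j c)) (swap x c refl)

  insertAt-[]≔ : ∀ {n} (r : Vec A n) (j : Fin (suc n)) (a b : A) → insertAt r j a [ j ]≔ b ≡ insertAt r j b
  insertAt-[]≔ r zero a b = refl
  insertAt-[]≔ (x ∷ r) (suc j) a b = cong (x ∷_) (insertAt-[]≔ r j a b)

  insertAt-[]≔-punchIn : ∀ {n} (r : Vec A n) (j : Fin (suc n)) (i : Fin n) (a b : A) →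
    insertAt r j a [ punchIn j i ]≔ b ≡ insertAt (r [ i ]≔ b) j a
  insertAt-[]≔-punchIn r zero i a b = refl
  insertAt-[]≔-punchIn (x ∷ r) (suc j) zero a b = refl
  insertAt-[]≔-punchIn (x ∷ r) (suc j) (suc i) a b = cong (x ∷_) (insertAt-[]≔-punchIn r j i a b)

  lookup∷[]≔-↭ : ∀ {n} (r : Vec A n) (i : Fin n) (b : A) →
    lookup r i ∷ toList (r [ i ]≔ b) ↭ b ∷ toList r
  lookup∷[]≔-↭ r@(_ ∷ _) i b = subst (λ r → lookup r i ∷ toList (r [ i ]≔ b) ↭ b ∷ toList r)
    (insertAt-removeAt r i) (inserted (removeAt r i) (lookup r i))
    where
    inserted : ∀ s c →
      lookup (insertAt s i c) i ∷ toList (insertAt s i c [ i ]≔ b) ↭ b ∷ toList (insertAt s i c)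
    inserted s c rewrite insertAt-lookup s i c | insertAt-[]≔ s i c b =
      ↭-trans (prep c (insertAt-↭ s i b)) (↭-trans (swap c b refl) (prep b (↭-sym (insertAt-↭ s i c))))

  ∈-toList⇒lookup : ∀ {n} {s : A} (v : Vec A n) → s ∈ toList v → ∃ λ i → lookup v i ≡ s
  ∈-toList⇒lookup (x ∷ v) (here refl) = zero , refl
  ∈-toList⇒lookup (x ∷ v) (there s∈v) with i , e ← ∈-toList⇒lookup v s∈v = suc i , e

  lookup∈ : ∀ {n} (v : Vec A n) i → lookup v i ∈ toList v
  lookup∈ v i = ∈-toList⁺ (∈-lookup i v)

  lookup-injective : ∀ {n} (v : Vec A n) → Unique (toList v) →
    ∀ {i i′} → lookup v i ≡ lookup v i′ → i ≡ i′
  lookup-injective (x ∷ v) u {zero} {zero} e = refl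
  lookup-injective (x ∷ v) (x∉v ∷ u) {zero} {suc i′} e = ⊥-elim (All.lookup x∉v (lookup∈ v i′) e)
  lookup-injective (x ∷ v) (x∉v ∷ u) {suc i} {zero} e = ⊥-elim (All.lookup x∉v (lookup∈ v i) (sym e))
  lookup-injective (x ∷ v) (_ ∷ u) {suc i} {suc i′} e = cong suc (lookup-injective v u e)

  ∉-toList⇒≢ : ∀ {n} {s : A} (v : Vec A n) → s ∉ toList v → ∀ i → s ≢ lookup v i
  ∉-toList⇒≢ v s∉v i s≡ = s∉v (subst (_∈ toList v) (sym s≡) (lookup∈ v i))

  map-injective : ∀ {B : Set} {f : B → A} → (∀ {a b} → f a ≡ f b → a ≡ b) →
    ∀ {n} {u v : Vec B n} → Vec.map f u ≡ Vec.map f v → u ≡ v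
  map-injective f-inj {u = []} {[]} _ = refl
  map-injective f-inj {u = a ∷ u} {b ∷ v} e with fa≡fb , fu≡fv ← ∷-injective e =
    cong₂ _∷_ (f-inj fa≡fb) (map-injective f-inj fu≡fv)

Consecutive : ∀ {B : Set} → B → B → List B → Set
Consecutive {B} p q xs = ∃₂ λ (ys zs : List B) → xs ≡ ys ++ p ∷ q ∷ zs

module _ {B : Set} {p q : B} where

  Consecutive-++ˡ : ∀ {xs} ys → Consecutive p q xs → Consecutive p q (ys ++ xs)
  Consecutive-++ˡ ys (as , bs , refl) = ys ++ as , bs , sym (++-assoc ys as _)

  Consecutive-++ʳ : ∀ {xs} ys → Consecutive p q xs → Consecutive p q (xs ++ ys)
  Consecutive-++ʳ ys (as , bs , refl) = as , bs ++ ys , ++-assoc as _ ys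

  Consecutive-reverse : ∀ {xs} → Consecutive p q xs → Consecutive q p (reverse xs)
  Consecutive-reverse (ys , zs , refl) = reverse zs , reverse ys , (begin
    reverse (ys ++ p ∷ q ∷ zs)                ≡⟨ reverse-++ ys (p ∷ q ∷ zs) ⟩
    reverse (p ∷ q ∷ zs) ++ reverse ys        ≡⟨ cong (_++ reverse ys) (unfold-reverse p (q ∷ zs)) ⟩
    (reverse (q ∷ zs) ++ [p]) ++ reverse ys   ≡⟨ cong (λ l → (l ++ [p]) ++ reverse ys) (unfold-reverse q zs) ⟩
    ((reverse zs ++ [q]) ++ [p]) ++ reverse ys ≡⟨ ++-assoc (reverse zs ++ [q]) [p] (reverse ys) ⟩
    (reverse zs ++ [q]) ++ p ∷ reverse ys     ≡⟨ ++-assoc (reverse zs) [q] (p ∷ reverse ys) ⟩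
    reverse zs ++ q ∷ p ∷ reverse ys          ∎)
    where
    open ≡-Reasoning
    [p] = p ∷ []
    [q] = q ∷ []

  Consecutive-zip : ∀ ys zs r → (p , q) ∈ zip (ys ++ p ∷ q ∷ zs) (List.drop 1 (ys ++ p ∷ q ∷ zs) ++ r)
  Consecutive-zip [] zs r = here refl
  Consecutive-zip (y ∷ []) zs r = there (here refl)
  Consecutive-zip (y ∷ ys@(_ ∷ _)) zs r = there (Consecutive-zip ys zs r)

  Consecutive⇒∈cycPairs : ∀ {xs} → Consecutive p q xs → (p , q) ∈ cycPairs xs
  Consecutive⇒∈cycPairs ([] , zs , refl) = Consecutive-zip [] zs (p ∷ [])
  Consecutive⇒∈cycPairs (ys@(y ∷ _) , zs , refl) = Consecutive-zip ys zs (y ∷ [])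

module SplitStar {A : Set} (_≟_ : DecidableEquality A) where

  -- Strings of length n = k + 2 over A; Move and Adj are Gen and the edge relation of Defs.
  Word : ℕ → Set
  Word k = Vec A (suc (suc k))

  Move : ∀ {k} → Word k → Word k → Set
  Move {k} u v = (v ≡ swap12 u)
               ⊎ (∃ λ (i : Fin k) → v ≡ sMinus i u)
               ⊎ (∃ λ (i : Fin k) → v ≡ sPlus i u)

  Adj : ∀ {k} → Word k → Word k → Set
  Adj u v = Move u v ⊎ Move v u

  Adj-sym : ∀ {k} {u v : Word k} → Adj u v → Adj v u
  Adj-sym (inj₁ m) = inj₂ m
  Adj-sym (inj₂ m) = inj₁ m

  swap12-adj : ∀ {k} (v : Word k) → Adj v (swap12 v)
  swap12-adj v = inj₁ (inj₁ refl)

  sMinus-adj : ∀ {k} (i : Fin k) (v : Word k) → Adj v (sMinus i v)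
  sMinus-adj i v = inj₁ (inj₂ (inj₁ (i , refl)))

  sPlus-adj : ∀ {k} (i : Fin k) (v : Word k) → Adj v (sPlus i v)
  sPlus-adj i v = inj₁ (inj₂ (inj₂ (i , refl)))

  Move-↭ : ∀ {k} {u v : Word k} → Move u v → toList v ↭ toList u
  Move-↭ {u = x ∷ y ∷ r} (inj₁ refl) = swap y x refl
  Move-↭ {u = x ∷ y ∷ r} (inj₂ (inj₁ (i , refl))) =
    ↭-trans (prep y (lookup∷[]≔-↭ r i x)) (swap y x refl)
  Move-↭ {u = x ∷ y ∷ r} (inj₂ (inj₂ (i , refl))) =
    ↭-trans (swap _ x refl) (prep x (lookup∷[]≔-↭ r i y))

  Adj-↭ : ∀ {k} {u v : Word k} → Adj u v → toList v ↭ toList u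
  Adj-↭ (inj₁ m) = Move-↭ m
  Adj-↭ (inj₂ m) = ↭-sym (Move-↭ m)

  first second : ∀ {k} → Word k → A
  first v = lookup v zero
  second v = lookup v (suc zero)

  pos : ∀ {k} → Fin k → Fin (suc (suc k))
  pos j = suc (suc j)

  -- Tail index j is string position j + 3.  Fixing the symbol there splits S_n^2 into n copies
  -- of S_{n-1}^2; copy j v is the symbol naming the copy that contains v.
  copy : ∀ {k} → Fin k → Word k → A
  copy j v = lookup v (pos j)

  head-first : ∀ {k} (v : Word k) → head v ≡ first v
  head-first (x ∷ _) = refl

  first-swap12 : ∀ {k} (v : Word k) → first (swap12 v) ≡ second v
  first-swap12 (x ∷ y ∷ r) = refl

  module _ {k : ℕ} (j : Fin k) where

    first-sPlus : ∀ v → first (sPlus j v) ≡ copy j v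
    first-sPlus (x ∷ y ∷ r) = refl

    second-sPlus : ∀ v → second (sPlus j v) ≡ first v
    second-sPlus (x ∷ y ∷ r) = refl

    copy-sPlus : ∀ v → copy j (sPlus j v) ≡ second v
    copy-sPlus (x ∷ y ∷ r) = lookup∘update j r y

    second-sMinus : ∀ v → second (sMinus j v) ≡ copy j v
    second-sMinus (x ∷ y ∷ r) = refl

    copy-sMinus : ∀ v → copy j (sMinus j v) ≡ first v
    copy-sMinus (x ∷ y ∷ r) = lookup∘update j r x

    copy-sPlus-other : ∀ {i} v → i ≢ j → copy j (sPlus i v) ≡ copy j v
    copy-sPlus-other (x ∷ y ∷ r) i≢j = lookup∘update′ (i≢j ∘ sym) r y

    copy-sMinus-other : ∀ {i} v → i ≢ j → copy j (sMinus i v) ≡ copy j v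
    copy-sMinus-other (x ∷ y ∷ r) i≢j = lookup∘update′ (i≢j ∘ sym) r x

  _≟ʷ_ : ∀ {n} → DecidableEquality (Vec A n)
  _≟ʷ_ = ≡-dec _≟_

  -- Vertices are arrangements of an arbitrary symbol set P rather than of [n]: a copy of
  -- S_{n-1}^2 inside S_n^2 consists of the arrangements of [n] minus one symbol.
  record Arrangement (P : A → Set) (xs : List A) : Set where
    field
      unique   : Unique xs
      sound    : ∀ {s} → s ∈ xs → P s
      complete : ∀ {s} → P s → s ∈ xs

  open Arrangement public

  Arr : ∀ {n} → (A → Set) → Vec A n → Set
  Arr P v = Arrangement P (toList v)

  module _ {P : A → Set} where

    Arrangement-resp-↭ : ∀ {xs ys} → xs ↭ ys → Arrangement P xs → Arrangement P ys
    Arrangement-resp-↭ p a = record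
      { unique = Unique-resp-↭ p (unique a)
      ; sound = λ s∈ys → sound a (∈-resp-↭ (↭-sym p) s∈ys)
      ; complete = λ ps → ∈-resp-↭ p (complete a ps)
      }

    Arr-Adj : ∀ {k} {u v : Word k} → Adj u v → Arr P u → Arr P v
    Arr-Adj u~v = Arrangement-resp-↭ (↭-sym (Adj-↭ u~v))

    Arr-lookup : ∀ {n} {v : Vec A n} → Arr P v → ∀ i → P (lookup v i)
    Arr-lookup {v = v} av i = sound av (lookup∈ v i)

    Arr-distinct : ∀ {n} {v : Vec A n} → Arr P v → ∀ {i i′} → i ≢ i′ → lookup v i ≢ lookup v i′
    Arr-distinct {v = v} av i≢i′ e = i≢i′ (lookup-injective v (unique av) e)

  _∖_ : (A → Set) → A → A → Set
  (P ∖ c) s = P s × s ≢ c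

  module _ {P : A → Set} {c : A} {xs : List A} where

    Arrangement-∷ : Arrangement (P ∖ c) xs → P c → Arrangement P (c ∷ xs)
    Arrangement-∷ a pc = record
      { unique = All.tabulate (λ s∈xs c≡s → proj₂ (sound a s∈xs) (sym c≡s)) ∷ unique a
      ; sound = λ { (here refl) → pc ; (there s∈xs) → proj₁ (sound a s∈xs) }
      ; complete = λ {s} ps → case s ≟ c of λ
          { (yes refl) → here refl
          ; (no s≢c) → there (complete a (ps , s≢c)) }
      }

    Arrangement-∷⁻ : Arrangement P (c ∷ xs) → Arrangement (P ∖ c) xs
    Arrangement-∷⁻ a with c∉xs ∷ u ← unique a = record
      { unique = u
      ; sound = λ s∈xs → sound a (there s∈xs) , λ s≡c → All.lookup c∉xs s∈xs (sym s≡c)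
      ; complete = λ (ps , s≢c) → case complete a ps of λ
          { (here s≡c) → ⊥-elim (s≢c s≡c)
          ; (there s∈xs) → s∈xs }
      }

  extend : ∀ {n} {P : A → Set} {x : Vec A n} → Arr P x → ∀ {E} → Unique E → All P E →
    ∃ λ D → Arrangement P (E ++ D)
  extend ax uE pE with D , E++D↭x ← ⊆⇒++-↭ uE (All.map (complete ax) pE) =
    D , Arrangement-resp-↭ (↭-sym E++D↭x) ax

  fresh : ∀ {n} {P : A → Set} {x : Vec A n} → Arr P x → (E : List A) → length E < n →
    ∃ λ s → P s × s ∉ E
  fresh {x = x} ax E |E|<n
    with s , s∈x , s∉E ← ∃∉-shorter _≟_ (unique ax) E (subst (length E <_) (sym (length-toList x)) |E|<n) =
    s , sound ax s∈x , s∉E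

  module _ {k : ℕ} {P : A → Set} where

    Move-first-≢ : ∀ {u v : Word k} → Move u v → Arr P u → first u ≢ first v
    Move-first-≢ {x ∷ y ∷ r} (inj₁ refl) au = Arr-distinct au {zero} {suc zero} (λ ())
    Move-first-≢ {x ∷ y ∷ r} (inj₂ (inj₁ (i , refl))) au = Arr-distinct au {zero} {suc zero} (λ ())
    Move-first-≢ {x ∷ y ∷ r} (inj₂ (inj₂ (i , refl))) au = Arr-distinct au {zero} {pos i} (λ ())

    Move-second-≢ : ∀ {u v : Word k} → Move u v → Arr P u → second u ≢ second v
    Move-second-≢ {x ∷ y ∷ r} (inj₁ refl) au = Arr-distinct au {suc zero} {zero} (λ ())
    Move-second-≢ {x ∷ y ∷ r} (inj₂ (inj₁ (i , refl))) au = Arr-distinct au {suc zero} {pos i} (λ ())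
    Move-second-≢ {x ∷ y ∷ r} (inj₂ (inj₂ (i , refl))) au = Arr-distinct au {suc zero} {zero} (λ ())

    Adj-first-≢ : ∀ {u v : Word k} → Adj u v → Arr P u → Arr P v → first u ≢ first v
    Adj-first-≢ (inj₁ m) au _ = Move-first-≢ m au
    Adj-first-≢ (inj₂ m) _ av = Move-first-≢ m av ∘ sym

    Adj-second-≢ : ∀ {u v : Word k} → Adj u v → Arr P u → Arr P v → second u ≢ second v
    Adj-second-≢ (inj₁ m) au _ = Move-second-≢ m au
    Adj-second-≢ (inj₂ m) _ av = Move-second-≢ m av ∘ sym

    Adj-≢ : ∀ {u v : Word k} → Adj u v → Arr P u → Arr P v → u ≢ v
    Adj-≢ u~v au av u≡v = Adj-first-≢ u~v au av (cong first u≡v)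

    Move-same-tail : ∀ {u v : Word k} → Move u v → Arr P u → (∀ i → copy i u ≡ copy i v) →
      v ≡ swap12 u
    Move-same-tail (inj₁ v≡) _ _ = v≡
    Move-same-tail {u} (inj₂ (inj₁ (i , refl))) au same =
      ⊥-elim (Arr-distinct au {pos i} {zero} (λ ()) (trans (same i) (copy-sMinus i u)))
    Move-same-tail {u} (inj₂ (inj₂ (i , refl))) au same =
      ⊥-elim (Arr-distinct au {pos i} {suc zero} (λ ()) (trans (same i) (copy-sPlus i u)))

    Adj-same-tail : ∀ {u v : Word k} → Adj u v → Arr P u → Arr P v → (∀ i → copy i u ≡ copy i v) →
      u ≡ swap12 v
    Adj-same-tail {x ∷ y ∷ r} (inj₁ m) au _ same with refl ← Move-same-tail m au same = refl
    Adj-same-tail (inj₂ m) _ av same = Move-same-tail m av (sym ∘ same)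

  -- Walks and Hamiltonian paths

  infixr 5 _∷⟨_⟩_

  data Walk {k : ℕ} : Word k → Word k → Set where
    [_]    : (a : Word k) → Walk a a
    _∷⟨_⟩_ : (a : Word k) {b c : Word k} → Adj a b → Walk b c → Walk a c

  module _ {k : ℕ} where

    vertices : ∀ {a b : Word k} → Walk a b → List (Word k)
    vertices [ a ] = a ∷ []
    vertices (a ∷⟨ _ ⟩ w) = a ∷ vertices w

    _++⟨_⟩_ : ∀ {a b c d : Word k} → Walk a b → Adj b c → Walk c d → Walk a d
    [ a ] ++⟨ e ⟩ w = a ∷⟨ e ⟩ w
    (a ∷⟨ e′ ⟩ w) ++⟨ e ⟩ w′ = a ∷⟨ e′ ⟩ (w ++⟨ e ⟩ w′)

    vertices-++ : ∀ {a b c d : Word k} (w : Walk a b) (e : Adj b c) (w′ : Walk c d) →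
      vertices (w ++⟨ e ⟩ w′) ≡ vertices w ++ vertices w′
    vertices-++ [ a ] e w′ = refl
    vertices-++ (a ∷⟨ _ ⟩ w) e w′ = cong (a ∷_) (vertices-++ w e w′)

    Consecutive-++⟨⟩ : ∀ {a b c d : Word k} (w : Walk a b) (e : Adj b c) (w′ : Walk c d) →
      Consecutive b c (vertices (w ++⟨ e ⟩ w′))
    Consecutive-++⟨⟩ [ a ] e (c ∷⟨ _ ⟩ w′) = [] , vertices w′ , refl
    Consecutive-++⟨⟩ [ a ] e [ c ] = [] , [] , refl
    Consecutive-++⟨⟩ (a ∷⟨ _ ⟩ w) e w′ = Consecutive-++ˡ (a ∷ []) (Consecutive-++⟨⟩ w e w′)

    reverseWalk : ∀ {a b : Word k} → Walk a b → Walk b a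
    reverseWalk [ a ] = [ a ]
    reverseWalk (a ∷⟨ e ⟩ w) = reverseWalk w ++⟨ Adj-sym e ⟩ [ a ]

    vertices-reverse : ∀ {a b : Word k} (w : Walk a b) → vertices (reverseWalk w) ≡ reverse (vertices w)
    vertices-reverse [ a ] = refl
    vertices-reverse (a ∷⟨ e ⟩ w) = begin
      vertices (reverseWalk w ++⟨ Adj-sym e ⟩ [ a ]) ≡⟨ vertices-++ (reverseWalk w) (Adj-sym e) [ a ] ⟩
      vertices (reverseWalk w) ++ a ∷ []            ≡⟨ cong (_++ a ∷ []) (vertices-reverse w) ⟩
      reverse (vertices w) ++ a ∷ []                ≡⟨ unfold-reverse a (vertices w) ⟨
      reverse (a ∷ vertices w)                     ∎
      where open ≡-Reasoning

  record HamPath {k : ℕ} (R : Word k → Set) (a b : Word k) : Set where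
    field
      walk     : Walk a b
      simple   : Unique (vertices walk)
      inside   : All R (vertices walk)
      spanning : ∀ {v} → R v → v ∈ vertices walk

  record FirstStep {k : ℕ} (R : Word k → Set) (a b : Word k) : Set where
    field
      next : Word k
      step : Adj a next
      rest : HamPath (λ v → R v × v ≢ a) next b

  module _ {k : ℕ} where

    HamPath-resp : ∀ {R R′ : Word k → Set} {a b} → (∀ {v} → R v → R′ v) → (∀ {v} → R′ v → R v) →
      HamPath R a b → HamPath R′ a b
    HamPath-resp f g h = record
      { walk = walk ; simple = simple ; inside = All.map f inside ; spanning = spanning ∘ g }
      where open HamPath h

    HamPath-[_] : (a : Word k) → HamPath (_≡ a) a a
    HamPath-[ a ] = record
      { walk = [ a ] ; simple = [] ∷ [] ; inside = refl ∷ [] ; spanning = λ { refl → here refl } }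

    HamPath-++ : ∀ {R₁ R₂ : Word k → Set} {a b c d} → HamPath R₁ a b → Adj b c → HamPath R₂ c d →
      (∀ {v} → R₁ v → R₂ v → ⊥) → HamPath (λ v → R₁ v ⊎ R₂ v) a d
    HamPath-++ h₁ e h₂ disjoint = record
      { walk = H₁.walk ++⟨ e ⟩ H₂.walk
      ; simple = subst Unique (sym eq) (Unique.++⁺ H₁.simple H₂.simple λ (v∈₁ , v∈₂) →
                   disjoint (All.lookup H₁.inside v∈₁) (All.lookup H₂.inside v∈₂))
      ; inside = subst (All _) (sym eq) (All.++⁺ (All.map inj₁ H₁.inside) (All.map inj₂ H₂.inside))
      ; spanning = λ where
          (inj₁ r) → subst (_ ∈_) (sym eq) (∈-++⁺ˡ (H₁.spanning r))
          (inj₂ r) → subst (_ ∈_) (sym eq) (∈-++⁺ʳ (vertices H₁.walk) (H₂.spanning r))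
      }
      where
      module H₁ = HamPath h₁
      module H₂ = HamPath h₂
      eq = vertices-++ H₁.walk e H₂.walk

    HamPath-head : ∀ {R : Word k → Set} {a b} → HamPath R a b → R a
    HamPath-head h with HamPath.walk h | HamPath.inside h
    ... | [ _ ] | r ∷ _ = r
    ... | _ ∷⟨ _ ⟩ _ | r ∷ _ = r

    HamPath-uncons : ∀ {R : Word k → Set} {a b} → HamPath R a b → a ≢ b → FirstStep R a b
    HamPath-uncons {R} {a} {b} h a≢b = split walk simple inside spanning
      where
      open HamPath h
      split : (w : Walk a b) → Unique (vertices w) → All R (vertices w) →
        (∀ {v} → R v → v ∈ vertices w) → FirstStep R a b
      split [ a ] _ _ _ = ⊥-elim (a≢b refl)
      split (_∷⟨_⟩_ a {a′} e w) u rs cover = record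
        { next = a′
        ; step = e
        ; rest = record
            { walk = w
            ; simple = Unique-tail u
            ; inside = All.zipWith (λ (r , a≢v) → r , a≢v ∘ sym) (All.tail rs , Unique-head u)
            ; spanning = λ (r , v≢a) → case cover r of λ
                { (here v≡a) → ⊥-elim (v≢a v≡a)
                ; (there v∈w) → v∈w }
            }
        }

    HamPath-reverse : ∀ {R : Word k → Set} {a b} (h : HamPath R a b) →
      Σ (HamPath R b a) λ h′ → vertices (HamPath.walk h′) ≡ reverse (vertices (HamPath.walk h))
    HamPath-reverse h = record
      { walk = reverseWalk walk
      ; simple = subst Unique (sym eq) (Unique-resp-↭ (↭-sym (↭-reverse _)) simple)
      ; inside = subst (All _) (sym eq) (All-resp-↭ (↭-sym (↭-reverse _)) inside)
      ; spanning = λ r → subst (_ ∈_) (sym eq) (∈-resp-↭ (↭-sym (↭-reverse _)) (spanning r))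
      } , eq
      where
      open HamPath h
      eq = vertices-reverse walk

  Walk-Arr : ∀ {k} {P : A → Set} {a b : Word k} → Arr P a → (w : Walk a b) → All (Arr P) (vertices w)
  Walk-Arr aa [ a ] = aa ∷ []
  Walk-Arr aa (a ∷⟨ e ⟩ w) = aa ∷ Walk-Arr (Arr-Adj e aa) w

  module _ {k : ℕ} where

    cycPairs-vertices : ∀ {a b : Word k} (w : Walk a b) →
      cycPairs (vertices w) ≡ zip (vertices w) (List.drop 1 (vertices w) ++ a ∷ [])
    cycPairs-vertices [ a ] = refl
    cycPairs-vertices (a ∷⟨ _ ⟩ w) = refl

    walk-closing : ∀ {a b z : Word k} (w : Walk a b) →
      (b , z) ∈ zip (vertices w) (List.drop 1 (vertices w) ++ z ∷ [])
    walk-closing [ a ] = here refl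
    walk-closing (a ∷⟨ _ ⟩ [ b ]) = there (here refl)
    walk-closing (a ∷⟨ _ ⟩ w@(_ ∷⟨ _ ⟩ _)) = there (walk-closing w)

    cycPairs-closing : ∀ {a b : Word k} (w : Walk a b) → (b , a) ∈ cycPairs (vertices w)
    cycPairs-closing w = subst (_ ∈_) (sym (cycPairs-vertices w)) (walk-closing w)

    module _ {R : Word k → Set} where

      walk-zip-Adj : ∀ {a b z} (w : Walk a b) → All R (vertices w) → R z → Adj b z →
        All (λ (u , v) → R u × R v × Adj u v) (zip (vertices w) (List.drop 1 (vertices w) ++ z ∷ []))
      walk-zip-Adj [ a ] (ra ∷ []) rz e = (ra , rz , e) ∷ []
      walk-zip-Adj (a ∷⟨ e ⟩ [ b ]) (ra ∷ rb ∷ []) rz e′ = (ra , rb , e) ∷ (rb , rz , e′) ∷ []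
      walk-zip-Adj (a ∷⟨ e ⟩ w@(b ∷⟨ _ ⟩ _)) (ra ∷ rs@(rb ∷ _)) rz e′ =
        (ra , rb , e) ∷ walk-zip-Adj w rs rz e′

      cycPairs-Adj : ∀ {a b} (w : Walk a b) → All R (vertices w) → Adj b a →
        All (λ (u , v) → R u × R v × Adj u v) (cycPairs (vertices w))
      cycPairs-Adj w@([ a ]) rs e = walk-zip-Adj w rs (All.head rs) e
      cycPairs-Adj w@(a ∷⟨ _ ⟩ _) rs e = walk-zip-Adj w rs (All.head rs) e

  module _ {k : ℕ} (j : Fin (suc k)) where

    insert : A → Word k → Word (suc k)
    insert c (x ∷ y ∷ r) = x ∷ y ∷ insertAt r j c

    remove : Word (suc k) → Word k
    remove (x ∷ y ∷ r) = x ∷ y ∷ removeAt r j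

    remove-insert : ∀ c v → remove (insert c v) ≡ v
    remove-insert c (x ∷ y ∷ r) = cong (λ t → x ∷ y ∷ t) (removeAt-insertAt r j c)

    insert-remove : ∀ v → insert (copy j v) (remove v) ≡ v
    insert-remove (x ∷ y ∷ r) = cong (λ t → x ∷ y ∷ t) (insertAt-removeAt r j)

    copy-insert : ∀ c v → copy j (insert c v) ≡ c
    copy-insert c (x ∷ y ∷ r) = insertAt-lookup r j c

    insert-injective : ∀ c {v w} → insert c v ≡ insert c w → v ≡ w
    insert-injective c {v} {w} e = trans (sym (remove-insert c v)) (trans (cong remove e) (remove-insert c w))

    insert-↭ : ∀ c v → toList (insert c v) ↭ c ∷ toList v
    insert-↭ c (x ∷ y ∷ r) = ↭-trans (prep x (prep y (insertAt-↭ r j c)))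
                               (↭-trans (prep x (swap y c refl)) (swap x c refl))

  module _ {k : ℕ} (j : Fin (suc k)) (c : A) where

    Move-insert : ∀ {u v} → Move u v → Move (insert j c u) (insert j c v)
    Move-insert {x ∷ y ∷ r} (inj₁ refl) = inj₁ refl
    Move-insert {x ∷ y ∷ r} (inj₂ (inj₁ (i , refl))) = inj₂ (inj₁ (punchIn j i ,
      cong₂ (λ a t → y ∷ a ∷ t) (sym (insertAt-punchIn r j c i)) (sym (insertAt-[]≔-punchIn r j i c x))))
    Move-insert {x ∷ y ∷ r} (inj₂ (inj₂ (i , refl))) = inj₂ (inj₂ (punchIn j i ,
      cong₂ (λ a t → a ∷ x ∷ t) (sym (insertAt-punchIn r j c i)) (sym (insertAt-[]≔-punchIn r j i c y))))

    Adj-insert : ∀ {u v} → Adj u v → Adj (insert j c u) (insert j c v)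
    Adj-insert (inj₁ m) = inj₁ (Move-insert m)
    Adj-insert (inj₂ m) = inj₂ (Move-insert m)

    Walk-insert : ∀ {a b} → Walk a b → Walk (insert j c a) (insert j c b)
    Walk-insert [ a ] = [ insert j c a ]
    Walk-insert (a ∷⟨ e ⟩ w) = insert j c a ∷⟨ Adj-insert e ⟩ Walk-insert w

    vertices-insert : ∀ {a b} (w : Walk a b) → vertices (Walk-insert w) ≡ List.map (insert j c) (vertices w)
    vertices-insert [ a ] = refl
    vertices-insert (a ∷⟨ e ⟩ w) = cong (insert j c a ∷_) (vertices-insert w)

  module _ {k : ℕ} (j : Fin (suc k)) {P : A → Set} where

    Arr-insert : ∀ {c} v → Arr (P ∖ c) v → P c → Arr P (insert j c v)
    Arr-insert v a pc = Arrangement-resp-↭ (↭-sym (insert-↭ j _ v)) (Arrangement-∷ a pc)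

    Arr-remove : ∀ v → Arr P v → Arr (P ∖ copy j v) (remove j v)
    Arr-remove v a = Arrangement-∷⁻ (Arrangement-resp-↭ (insert-↭ j (copy j v) (remove j v))
                       (subst (Arr P) (sym (insert-remove j v)) a))

    HamPath-insert : ∀ {c a b} → P c → HamPath (Arr (P ∖ c)) a b →
      HamPath (λ v → Arr P v × copy j v ≡ c) (insert j c a) (insert j c b)
    HamPath-insert {c} pc h = record
      { walk = Walk-insert j c walk
      ; simple = subst Unique (sym eq) (Unique.map⁺ (insert-injective j c) simple)
      ; inside = subst (All _) (sym eq)
                   (All.map⁺ (All.map (λ {v} av → Arr-insert v av pc , copy-insert j c v) inside))
      ; spanning = λ { {v} (av , refl) → subst (v ∈_) (sym eq)
                         (subst (_∈ List.map (insert j (copy j v)) (vertices walk)) (insert-remove j v)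
                           (∈-map⁺ (insert j (copy j v)) (spanning (Arr-remove v av)))) }
      }
      where
      open HamPath h
      eq = vertices-insert j c walk

  transpose : A → A → A → A
  transpose a b s with s ≟ a | s ≟ b
  ... | yes _ | _     = b
  ... | no _  | yes _ = a
  ... | no _  | no _  = s

  data TransposeView (a b s : A) : A → Set where
    at-a      : s ≡ a → TransposeView a b s b
    at-b      : s ≡ b → TransposeView a b s a
    elsewhere : s ≢ a → s ≢ b → TransposeView a b s s

  transpose-view : ∀ a b s → TransposeView a b s (transpose a b s)
  transpose-view a b s with s ≟ a | s ≟ b
  ... | yes s≡a | _     = at-a s≡a
  ... | no _    | yes s≡b = at-b s≡b
  ... | no s≢a  | no s≢b  = elsewhere s≢a s≢b

  transpose-a : ∀ a b → transpose a b a ≡ b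
  transpose-a a b with transpose a b a | transpose-view a b a
  ... | _ | at-a _ = refl
  ... | _ | at-b a≡b = a≡b
  ... | _ | elsewhere a≢a _ = ⊥-elim (a≢a refl)

  transpose-b : ∀ a b → transpose a b b ≡ a
  transpose-b a b with transpose a b b | transpose-view a b b
  ... | _ | at-a b≡a = b≡a
  ... | _ | at-b _ = refl
  ... | _ | elsewhere _ b≢b = ⊥-elim (b≢b refl)

  transpose-other : ∀ {a b s} → s ≢ a → s ≢ b → transpose a b s ≡ s
  transpose-other {a} {b} {s} s≢a s≢b with transpose a b s | transpose-view a b s
  ... | _ | at-a s≡a = ⊥-elim (s≢a s≡a)
  ... | _ | at-b s≡b = ⊥-elim (s≢b s≡b)
  ... | _ | elsewhere _ _ = refl

  transpose-involutive : ∀ a b s → transpose a b (transpose a b s) ≡ s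
  transpose-involutive a b s with transpose a b s | transpose-view a b s
  ... | _ | at-a refl = transpose-b s b
  ... | _ | at-b refl = transpose-a a s
  ... | _ | elsewhere s≢a s≢b = transpose-other s≢a s≢b

  transpose-injective : ∀ a b {s t} → transpose a b s ≡ transpose a b t → s ≡ t
  transpose-injective a b {s} {t} e =
    trans (sym (transpose-involutive a b s)) (trans (cong (transpose a b) e) (transpose-involutive a b t))

  transpose-closed : ∀ {P : A → Set} {a b s} → P a → P b → P s → P (transpose a b s)
  transpose-closed {a = a} {b} {s} pa pb ps with transpose a b s | transpose-view a b s
  ... | _ | at-a _ = pb
  ... | _ | at-b _ = pa
  ... | _ | elsewhere _ _ = ps

  relabel : ∀ {n} → A → A → Vec A n → Vec A n
  relabel a b = Vec.map (transpose a b)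

  Arr-relabel : ∀ {n} {P : A → Set} {a b} {v : Vec A n} → P a → P b → Arr P v → Arr P (relabel a b v)
  Arr-relabel {P = P} {a} {b} {v} pa pb av = subst (Arrangement P) (sym (toList-map (transpose a b) v)) (record
    { unique = Unique.map⁺ (transpose-injective a b) (unique av)
    ; sound = λ s∈ → case ∈-map⁻ (transpose a b) s∈ of λ
        { (t , t∈v , refl) → transpose-closed {P} pa pb (sound av t∈v) }
    ; complete = λ {s} ps → subst (_∈ _) (transpose-involutive a b s)
        (∈-map⁺ (transpose a b) (complete av (transpose-closed {P} pa pb ps)))
    })

  place : ∀ {n} → Fin n → A → Vec A n → Vec A n
  place i s v = relabel (lookup v i) s v

  module _ {n} {P : A → Set} {v : Vec A n} (av : Arr P v) where

    Arr-place : ∀ {i s} → P s → Arr P (place i s v)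
    Arr-place {i} ps = Arr-relabel (Arr-lookup av i) ps av

    lookup-place : ∀ i s → lookup (place i s v) i ≡ s
    lookup-place i s = trans (lookup-map i _ v) (transpose-a _ s)

    lookup-place-other : ∀ {i i′ s} → i′ ≢ i → lookup v i′ ≢ s → lookup (place i s v) i′ ≡ lookup v i′
    lookup-place-other {i} {i′} i′≢i v≢s =
      trans (lookup-map i′ _ v) (transpose-other (Arr-distinct av i′≢i) v≢s)

  record Prescribed {k : ℕ} (P : A → Set) (j : Fin k) (q b a : A) : Set where
    field
      word    : Word k
      arr     : Arr P word
      first≡  : first word ≡ q
      second≡ : second word ≡ b
      copy≡   : copy j word ≡ a

  prescribe : ∀ {k} {P : A → Set} (j : Fin k) {x : Word k} → Arr P x → ∀ {q b a} → P q → P b → P a →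
    q ≢ b → q ≢ a → b ≢ a → Prescribed P j q b a
  prescribe j {x} ax {q} {b} {a} pq pb pa q≢b q≢a b≢a = record
    { word = w₃
    ; arr = Arr-place a₂ pa
    ; first≡ = trans (lookup-place-other a₂ (λ ()) (λ e → q≢a (trans (sym w₂-first) e))) w₂-first
    ; second≡ = trans (lookup-place-other a₂ (λ ()) (λ e → b≢a (trans (sym w₂-second) e))) w₂-second
    ; copy≡ = lookup-place a₂ (pos j) a
    }
    where
    w₁ = place zero q x
    a₁ = Arr-place ax {zero} pq
    w₂ = place (suc zero) b w₁
    a₂ = Arr-place a₁ {suc zero} pb
    w₃ = place (pos j) a w₂
    w₁-first : first w₁ ≡ q
    w₁-first = lookup-place ax zero q
    w₂-first : first w₂ ≡ q
    w₂-first = trans (lookup-place-other a₁ (λ ()) (λ e → q≢b (trans (sym w₁-first) e))) w₁-first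
    w₂-second : second w₂ ≡ b
    w₂-second = lookup-place a₁ (suc zero) b

  other : ∀ {k} → Fin (suc (suc k)) → Fin (suc (suc k))
  other zero = suc zero
  other (suc _) = zero

  other-≢ : ∀ {k} (j : Fin (suc (suc k))) → pos (other j) ≢ pos j
  other-≢ zero ()
  other-≢ (suc j) ()

  module _ {k : ℕ} {P : A → Set} (j : Fin (suc (suc k))) where

    private
      W = Word (suc (suc k))
      c = pos j
      t = pos (other j)

    record Sibling (x : W) (i : Fin (suc (suc (suc (suc k))))) (d : A) : Set where
      field
        word   : W
        arr    : Arr P word
        copy≡  : copy j word ≡ copy j x
        at-i   : lookup word i ≡ d
        word≢x : word ≢ x

    -- Put d at position i by a transposition; if it is there already, move the other head
    -- position instead, using a second tail symbol (this needs n ≥ 4).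
    sibling : ∀ {x} → Arr P x → ∀ {d} → P d → d ≢ copy j x → ∀ i i′ → i ≢ i′ →
      i ≢ c → i′ ≢ c → i ≢ t → i′ ≢ t → Sibling x i d
    sibling {x} ax {d} pd d≢X i i′ i≢i′ i≢c i′≢c i≢t i′≢t with lookup x i ≟ d
    ... | no xᵢ≢d = record
      { word = place i d x
      ; arr = Arr-place ax pd
      ; copy≡ = lookup-place-other ax (λ e → i≢c (sym e)) (λ e → d≢X (sym e))
      ; at-i = lookup-place ax i d
      ; word≢x = λ e≡x → xᵢ≢d (trans (cong (λ v → lookup v i) (sym e≡x)) (lookup-place ax i d))
      }
    ... | yes xᵢ≡d = record
      { word = place i′ (lookup x t) x
      ; arr = Arr-place ax (Arr-lookup ax t)
      ; copy≡ = lookup-place-other ax (λ e → i′≢c (sym e)) (Arr-distinct ax (other-≢ j ∘ sym))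
      ; at-i = trans (lookup-place-other ax i≢i′ (Arr-distinct ax i≢t)) xᵢ≡d
      ; word≢x = λ e≡x → Arr-distinct ax (λ e → i′≢t (sym e))
               (trans (sym (lookup-place ax i′ (lookup x t))) (cong (λ v → lookup v i′) e≡x))
      }

    record Link (x : W) (d : A) : Set where
      field
        source        : W
        target        : W
        source-arr    : Arr P source
        source-copy   : copy j source ≡ copy j x
        source≢x      : source ≢ x
        adj           : Adj source target
        target-copy   : copy j target ≡ d

    module _ {x} (ax : Arr P x) {d} (pd : P d) (d≢X : d ≢ copy j x) where

      private
        s⁺ : Sibling x (suc zero) d
        s⁺ = sibling ax pd d≢X (suc zero) zero (λ ()) (λ ()) (λ ()) (λ ()) (λ ())
        s⁻ : Sibling x zero d
        s⁻ = sibling ax pd d≢X zero (suc zero) (λ ()) (λ ()) (λ ()) (λ ()) (λ ())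
        module S⁺ = Sibling s⁺
        module S⁻ = Sibling s⁻

      link⁺ : Link x d
      link⁺ = record
        { source = S⁺.word ; target = sPlus j S⁺.word ; source-arr = S⁺.arr ; source-copy = S⁺.copy≡
        ; source≢x = S⁺.word≢x ; adj = sPlus-adj j S⁺.word
        ; target-copy = trans (copy-sPlus j S⁺.word) S⁺.at-i }

      link⁻ : Link x d
      link⁻ = record
        { source = S⁻.word ; target = sMinus j S⁻.word ; source-arr = S⁻.arr ; source-copy = S⁻.copy≡
        ; source≢x = S⁻.word≢x ; adj = sMinus-adj j S⁻.word
        ; target-copy = trans (copy-sMinus j S⁻.word) S⁻.at-i }

      -- The targets of link⁺ and link⁻ differ: their second symbols are the first symbol and
      -- the copy symbol of a single arrangement.
      linkAvoiding : ∀ y → Σ (Link x d) λ L → Link.target L ≢ y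
      linkAvoiding y = case sPlus j S⁺.word ≟ʷ y of λ
        { (no t⁺≢y) → link⁺ , t⁺≢y
        ; (yes t⁺≡y) → link⁻ , λ t⁻≡y → Arr-distinct S⁺.arr {zero} {c} (λ ()) (begin
            first S⁺.word              ≡⟨ second-sPlus j S⁺.word ⟨
            second (sPlus j S⁺.word)   ≡⟨ cong second (trans t⁺≡y (sym t⁻≡y)) ⟩
            second (sMinus j S⁻.word)  ≡⟨ second-sMinus j S⁻.word ⟩
            copy j S⁻.word             ≡⟨ trans S⁻.copy≡ (sym S⁺.copy≡) ⟩
            copy j S⁺.word             ∎) }
        where open ≡-Reasoning

  -- Hamiltonian connectivity

  HamiltonConnected : ℕ → Set₁
  HamiltonConnected k = ∀ (P : A → Set) {a b : Word k} → Arr P a → Arr P b → a ≢ b → HamPath (Arr P) a b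

  module Copies {k : ℕ} (hc : HamiltonConnected (suc k)) (j : Fin (suc (suc k))) {P : A → Set} where

    private
      W = Word (suc (suc k))

    InCopies : List A → W → Set
    InCopies L v = Arr P v × copy j v ∈ L

    PathThrough : List A → W → W → Set
    PathThrough L = HamPath (InCopies L)

    PathThrough-resp-↭ : ∀ {L L′ x y} → L ↭ L′ → PathThrough L x y → PathThrough L′ x y
    PathThrough-resp-↭ p =
      HamPath-resp (λ (av , v∈) → av , ∈-resp-↭ p v∈) (λ (av , v∈) → av , ∈-resp-↭ (↭-sym p) v∈)

    PathThrough-++ : ∀ {L₁ L₂ a b c d} → PathThrough L₁ a b → Adj b c → PathThrough L₂ c d →
      Disjoint L₁ L₂ → PathThrough (L₁ ++ L₂) a d
    PathThrough-++ {L₁} p₁ e p₂ L₁#L₂ = HamPath-resp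
      (λ { (inj₁ (av , v∈)) → av , ∈-++⁺ˡ v∈ ; (inj₂ (av , v∈)) → av , ∈-++⁺ʳ L₁ v∈ })
      (λ (av , v∈) → case ∈-++⁻ L₁ v∈ of λ
        { (inj₁ v∈₁) → inj₁ (av , v∈₁)
        ; (inj₂ v∈₂) → inj₂ (av , v∈₂) })
      (HamPath-++ p₁ e p₂ λ (_ , v∈₁) (_ , v∈₂) → L₁#L₂ (v∈₁ , v∈₂))

    PathThrough-spanning : ∀ {L x y} → Arrangement P L → PathThrough L x y → HamPath (Arr P) x y
    PathThrough-spanning aL = HamPath-resp proj₁ λ {v} av → av , complete aL (Arr-lookup av (pos j))

    withinCopy : ∀ {x e} → Arr P x → Arr P e → copy j e ≡ copy j x → x ≢ e →
      PathThrough (copy j x ∷ []) x e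
    withinCopy {x} {e} ax ae e~x x≢e =
      subst₂ (PathThrough (X ∷ [])) (insert-remove j x) e-restored
        (HamPath-resp (λ (av , v~X) → av , here v~X) (λ { (av , here v~X) → av , v~X })
          (HamPath-insert j (Arr-lookup ax (pos j))
            (hc (P ∖ X) (Arr-remove j x ax) (subst (λ c → Arr (P ∖ c) (remove j e)) e~x (Arr-remove j e ae))
              λ x′≡e′ → x≢e (trans (sym (insert-remove j x))
                                   (trans (cong (insert j X) x′≡e′) e-restored)))))
      where
      X = copy j x
      e-restored : insert j X (remove j e) ≡ e
      e-restored = trans (cong (λ c → insert j c (remove j e)) (sym e~x)) (insert-remove j e)

    PathThrough-∷ : ∀ {X L a b c d} → PathThrough (X ∷ []) a b → Adj b c → PathThrough L c d → X ∉ L →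
      PathThrough (X ∷ L) a d
    PathThrough-∷ p₁ e p₂ X∉L = PathThrough-++ p₁ e p₂ λ { (here refl , X∈L) → X∉L X∈L }

    Link-path : ∀ {x d} → Arr P x → (L : Link j x d) → PathThrough (copy j x ∷ []) x (Link.source L)
    Link-path ax L = withinCopy ax source-arr source-copy (source≢x ∘ sym)
      where open Link L

    throughCopies : ∀ D {x y} → Arr P x → Arr P y → Unique (copy j x ∷ copy j y ∷ D) → All P D →
      PathThrough (copy j x ∷ copy j y ∷ D) x y
    throughCopies [] {x} {y} ax ay ((X≢Y ∷ []) ∷ _) []
      with L , target≢y ← linkAvoiding j ax (Arr-lookup ay (pos j)) (X≢Y ∘ sym) y =
      subst (λ z → PathThrough (copy j x ∷ z ∷ []) x y) L.target-copy
        (PathThrough-∷ (Link-path ax L) L.adj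
          (withinCopy (Arr-Adj L.adj L.source-arr) ay (sym L.target-copy) target≢y)
          λ { (here X≡t) → X≢Y (trans X≡t L.target-copy) })
      where module L = Link L
    throughCopies (d ∷ D) {x} {y} ax ay u@((X≢Y ∷ X≢d ∷ X∉D) ∷ uYdD) (pd ∷ pD) =
      PathThrough-resp-↭ (prep _ (swap d _ refl))
        (PathThrough-∷ (Link-path ax L) L.adj
          (subst (λ z → PathThrough (z ∷ copy j y ∷ D) L.target y) L.target-copy
            (throughCopies D (Arr-Adj L.adj L.source-arr) ay
              (subst (λ z → Unique (z ∷ copy j y ∷ D)) (sym L.target-copy)
                (Unique-resp-↭ (swap _ d refl) uYdD))
              pD))
          (All.All¬⇒¬Any (X≢d ∷ X≢Y ∷ X∉D)))
      where
      L = link⁺ j ax pd (X≢d ∘ sym)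
      module L = Link L

    detour : ∀ {s t x y L} → Arr P s → (f : FirstStep (InCopies (copy j s ∷ [])) s t) → Adj s x →
      PathThrough L x y → Adj y (FirstStep.next f) → copy j s ∉ L → HamPath (InCopies (copy j s ∷ L)) s t
    detour {s} {L = L} as f s~x p y~next c∉L =
      HamPath-resp to from (HamPath-++ (HamPath-++ HamPath-[ s ] s~x p disjoint₁) y~next rest disjoint₂)
      where
      open FirstStep f
      c = copy j s
      to : ∀ {v} → (v ≡ s ⊎ InCopies L v) ⊎ (InCopies (c ∷ []) v × v ≢ s) → InCopies (c ∷ L) v
      to (inj₁ (inj₁ refl)) = as , here refl
      to (inj₁ (inj₂ (av , v∈L))) = av , there v∈L
      to (inj₂ ((av , v∈c) , _)) = av , ∈-++⁺ˡ v∈c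
      from : ∀ {v} → InCopies (c ∷ L) v → (v ≡ s ⊎ InCopies L v) ⊎ (InCopies (c ∷ []) v × v ≢ s)
      from (av , there v∈L) = inj₁ (inj₂ (av , v∈L))
      from {v} (av , here v~c) = case v ≟ʷ s of λ
        { (yes v≡s) → inj₁ (inj₁ v≡s)
        ; (no v≢s) → inj₂ ((av , here v~c) , v≢s) }
      disjoint₁ : ∀ {v} → v ≡ s → InCopies L v → ⊥
      disjoint₁ refl (_ , c∈L) = c∉L c∈L
      disjoint₂ : ∀ {v} → v ≡ s ⊎ InCopies L v → InCopies (c ∷ []) v × v ≢ s → ⊥
      disjoint₂ (inj₁ v≡s) (_ , v≢s) = v≢s v≡s
      disjoint₂ (inj₂ (_ , v∈L)) ((_ , here v~c) , _) = c∉L (subst (_∈ L) v~c v∈L)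

    Consecutive-detour : ∀ {s t x y L a b} (as : Arr P s) (f : FirstStep (InCopies (copy j s ∷ [])) s t)
      (s~x : Adj s x) (p : PathThrough L x y) (y~next : Adj y (FirstStep.next f)) (c∉L : copy j s ∉ L) →
      Consecutive a b (vertices (HamPath.walk p)) →
      Consecutive a b (vertices (HamPath.walk (detour as f s~x p y~next c∉L)))
    Consecutive-detour {s} as f s~x p y~next c∉L ab =
      subst (Consecutive _ _)
        (sym (vertices-++ (s ∷⟨ s~x ⟩ HamPath.walk p) y~next (HamPath.walk (FirstStep.rest f))))
        (Consecutive-++ʳ _ (Consecutive-++ˡ (s ∷ []) ab))

    acrossCopies : ∀ {a b} → Arr P a → Arr P b → copy j a ≢ copy j b → HamPath (Arr P) a b
    acrossCopies aa ab A≢B =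
      PathThrough-spanning aL (throughCopies D aa ab (unique aL) (All.tabulate (sound aL ∘ there ∘ there)))
      where
      D,aL = extend aa ((A≢B ∷ []) ∷ [] ∷ []) (Arr-lookup aa (pos j) ∷ Arr-lookup ab (pos j) ∷ [])
      D = proj₁ D,aL
      aL = proj₂ D,aL

    -- Leave the copy of a at once through s_j^+, cover all other copies, and re-enter through
    -- s_j^+ at the second vertex of a Hamiltonian path of the copy from a to b.
    insideCopy : ∀ {a b} → Arr P a → Arr P b → a ≢ b → copy j a ≡ copy j b → HamPath (Arr P) a b
    insideCopy {a} aa ab a≢b A≡B =
      PathThrough-spanning aL (detour aa f (sPlus-adj j a) (throughCopies D ax ay (Unique-tail (unique aL)) pD)
                        (Adj-sym (sPlus-adj j a″)) (Unique[x∷xs]⇒x∉xs (unique aL)))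
      where
      f = HamPath-uncons (withinCopy aa ab (sym A≡B) a≢b) a≢b
      a″ = FirstStep.next f
      a″∈ = proj₁ (HamPath-head (FirstStep.rest f))
      aa″ : Arr P a″
      aa″ = proj₁ a″∈
      c = copy j a
      a″-copy : copy j a″ ≡ c
      a″-copy with here e ← proj₂ a″∈ = e
      ax = Arr-Adj (sPlus-adj j a) aa
      ay = Arr-Adj (sPlus-adj j a″) aa″
      X = copy j (sPlus j a)
      Y = copy j (sPlus j a″)
      c≢X : c ≢ X
      c≢X c≡X = Arr-distinct aa {pos j} {suc zero} (λ ()) (trans c≡X (copy-sPlus j a))
      c≢Y : c ≢ Y
      c≢Y c≡Y = Arr-distinct aa″ {pos j} {suc zero} (λ ()) (trans a″-copy (trans c≡Y (copy-sPlus j a″)))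
      X≢Y : X ≢ Y
      X≢Y X≡Y = Adj-second-≢ (FirstStep.step f) aa aa″
                  (trans (sym (copy-sPlus j a)) (trans X≡Y (copy-sPlus j a″)))
      D,aL = extend aa {c ∷ X ∷ Y ∷ []} ((c≢X ∷ c≢Y ∷ []) ∷ (X≢Y ∷ []) ∷ [] ∷ [])
               (Arr-lookup aa (pos j) ∷ Arr-lookup ax (pos j) ∷ Arr-lookup ay (pos j) ∷ [])
      D = proj₁ D,aL
      aL = proj₂ D,aL
      pD : All P D
      pD = All.tabulate (sound aL ∘ there ∘ there ∘ there)

  hamiltonConnected-step : ∀ {k} → HamiltonConnected (suc k) → HamiltonConnected (suc (suc k))
  hamiltonConnected-step hc P {a} {b} aa ab a≢b = case copy zero a ≟ copy zero b of λ
    { (yes A≡B) → insideCopy aa ab a≢b A≡B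
    ; (no A≢B) → acrossCopies aa ab A≢B }
    where open Copies hc zero

  -- S_3^2 is a prism on the six arrangements word i of x y z.  Each tour below is a
  -- Hamiltonian path from word 0F, checked by listing the indices of its vertices.
  module Prism {P : A → Set} {x y z : A} (axyz : Arr P (x ∷ y ∷ z ∷ [])) where

    σ : Fin 6 → Vec (Fin 3) 3
    σ 0F = 0F ∷ 1F ∷ 2F ∷ []
    σ 1F = 1F ∷ 0F ∷ 2F ∷ []
    σ 2F = 2F ∷ 0F ∷ 1F ∷ []
    σ 3F = 1F ∷ 2F ∷ 0F ∷ []
    σ 4F = 0F ∷ 2F ∷ 1F ∷ []
    σ 5F = 2F ∷ 1F ∷ 0F ∷ []

    σ-injective : ∀ i i′ → σ i ≡ σ i′ → i ≡ i′
    σ-injective = from-yes (all? λ i → all? λ i′ → σ i ≟σ σ i′ →-dec i Fin.≟ i′)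
      where _≟σ_ = ≡-dec Fin._≟_

    σ-surjective : ∀ a b c → a ≢ b → a ≢ c → b ≢ c → ∃ λ i → σ i ≡ a ∷ b ∷ c ∷ []
    σ-surjective = from-yes (all? λ a → all? λ b → all? λ c →
      ¬? (a Fin.≟ b) →-dec ¬? (a Fin.≟ c) →-dec ¬? (b Fin.≟ c) →-dec
      any? λ i → ≡-dec Fin._≟_ (σ i) (a ∷ b ∷ c ∷ []))

    word : Fin 6 → Word 1
    word i = Vec.map (lookup (x ∷ y ∷ z ∷ [])) (σ i)

    word-injective : ∀ {i i′} → word i ≡ word i′ → i ≡ i′
    word-injective = σ-injective _ _ ∘ map-injective (lookup-injective (x ∷ y ∷ z ∷ []) (unique axyz))

    word-complete : ∀ {v} → Arr P v → ∃ λ i → v ≡ word i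
    word-complete {v@(a ∷ b ∷ c ∷ [])} av = i , (begin
      v                                     ≡⟨ entries ⟨
      Vec.map (lookup xyz) (Vec.tabulate ι) ≡⟨ cong (Vec.map (lookup xyz)) σi≡ ⟨
      word i                                ∎)
      where
      open ≡-Reasoning
      xyz = x ∷ y ∷ z ∷ []
      index : ∀ p → ∃ λ ι → lookup xyz ι ≡ lookup v p
      index p = ∈-toList⇒lookup xyz (complete axyz (Arr-lookup av p))
      ι = proj₁ ∘ index
      index≡ : ∀ p → lookup xyz (ι p) ≡ lookup v p
      index≡ = proj₂ ∘ index
      ι-injective : ∀ {p p′} → p ≢ p′ → ι p ≢ ι p′
      ι-injective {p} {p′} p≢p′ ιp≡ιp′ =
        Arr-distinct av p≢p′ (trans (sym (index≡ p)) (trans (cong (lookup xyz) ιp≡ιp′) (index≡ p′)))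
      found = σ-surjective (ι 0F) (ι 1F) (ι 2F) (ι-injective λ ()) (ι-injective λ ()) (ι-injective λ ())
      i = proj₁ found
      σi≡ = proj₂ found
      entries = cong₂ _∷_ (index≡ 0F) (cong₂ _∷_ (index≡ 1F) (cong (_∷ []) (index≡ 2F)))

    Enumerates : List (Fin 6) → Set
    Enumerates ts = Unique ts × (∀ t → t ∈ ts)

    enumerates? : Decidable Enumerates
    enumerates? ts = unique? ts ×-dec all? (_∈? ts)
      where
      open import Data.List.Relation.Unary.Unique.DecPropositional Fin._≟_ using (unique?)
      open import Data.List.Membership.DecPropositional Fin._≟_ using (_∈?_)

    fromTour : ∀ i (w : Walk (word 0F) (word i)) ts → vertices w ≡ List.map word ts →
      {True (enumerates? ts)} → HamPath (Arr P) (word 0F) (word i)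
    fromTour i w ts eq {ok} = record
      { walk = w
      ; simple = subst Unique (sym eq) (Unique.map⁺ word-injective unique-ts)
      ; inside = Walk-Arr axyz w
      ; spanning = λ av → case word-complete av of λ
          { (t , refl) → subst (_ ∈_) (sym eq) (∈-map⁺ word (all-ts t)) }
      }
      where
      unique-ts = proj₁ (toWitness ok)
      all-ts = proj₂ (toWitness ok)

    private
      ⇄ : ∀ {v : Word 1} → Adj v (swap12 v)
      ⇄ = swap12-adj _
      ⁺ : ∀ {v : Word 1} → Adj v (sPlus zero v)
      ⁺ = sPlus-adj zero _
      ⁻ : ∀ {v : Word 1} → Adj v (sMinus zero v)
      ⁻ = sMinus-adj zero _

    tour : ∀ i → i ≢ 0F → HamPath (Arr P) (word 0F) (word i)
    tour 0F 0≢0 = ⊥-elim (0≢0 refl)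
    tour 1F _ = fromTour 1F
      (word 0F ∷⟨ ⁺ ⟩ word 2F ∷⟨ ⁺ ⟩ word 3F ∷⟨ ⇄ ⟩ word 5F ∷⟨ ⁺ ⟩ word 4F ∷⟨ ⁺ ⟩ [ word 1F ])
      (0F ∷ 2F ∷ 3F ∷ 5F ∷ 4F ∷ 1F ∷ []) refl
    tour 2F _ = fromTour 2F
      (word 0F ∷⟨ ⇄ ⟩ word 1F ∷⟨ ⁻ ⟩ word 4F ∷⟨ ⁻ ⟩ word 5F ∷⟨ ⇄ ⟩ word 3F ∷⟨ ⁻ ⟩ [ word 2F ])
      (0F ∷ 1F ∷ 4F ∷ 5F ∷ 3F ∷ 2F ∷ []) refl
    tour 3F _ = fromTour 3F
      (word 0F ∷⟨ ⇄ ⟩ word 1F ∷⟨ ⁺ ⟩ word 5F ∷⟨ ⁺ ⟩ word 4F ∷⟨ ⇄ ⟩ word 2F ∷⟨ ⁺ ⟩ [ word 3F ])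
      (0F ∷ 1F ∷ 5F ∷ 4F ∷ 2F ∷ 3F ∷ []) refl
    tour 4F _ = fromTour 4F
      (word 0F ∷⟨ ⇄ ⟩ word 1F ∷⟨ ⁺ ⟩ word 5F ∷⟨ ⇄ ⟩ word 3F ∷⟨ ⁻ ⟩ word 2F ∷⟨ ⇄ ⟩ [ word 4F ])
      (0F ∷ 1F ∷ 5F ∷ 3F ∷ 2F ∷ 4F ∷ []) refl
    tour 5F _ = fromTour 5F
      (word 0F ∷⟨ ⇄ ⟩ word 1F ∷⟨ ⁻ ⟩ word 4F ∷⟨ ⇄ ⟩ word 2F ∷⟨ ⁺ ⟩ word 3F ∷⟨ ⇄ ⟩ [ word 5F ])
      (0F ∷ 1F ∷ 4F ∷ 2F ∷ 3F ∷ 5F ∷ []) refl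

  hamiltonConnected-base : HamiltonConnected 1
  hamiltonConnected-base P {x ∷ y ∷ z ∷ []} aa ab a≢b with i , refl ← Prism.word-complete aa ab =
    Prism.tour aa i λ { refl → a≢b refl }

  hamiltonConnected : ∀ k → HamiltonConnected (suc k)
  hamiltonConnected zero = hamiltonConnected-base
  hamiltonConnected (suc k) = hamiltonConnected-step (hamiltonConnected k)

  -- Two Hamiltonian paths through prescribed edges

  module Routes {k : ℕ} (j : Fin (suc (suc k))) {P : A → Set} where

    open Copies (hamiltonConnected k) j {P}

    private
      W = Word (suc (suc k))

    UsesEdge : W → List W → Set
    UsesEdge w vs = Consecutive w (sPlus j w) vs ⊎ Consecutive (sPlus j w) w vs

    record Via (B : List A) (x y a b : W) : Set where
      field
        copies     : List A
        path       : PathThrough copies x y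
        complement : Arrangement P (B ++ copies)
        crosses    : Consecutive a b (vertices (HamPath.walk path))

    Via-reverse : ∀ {B x y a b} → Via B x y a b → Via B y x b a
    Via-reverse V = record
      { copies = copies
      ; path = proj₁ reversed
      ; complement = complement
      ; crosses = subst (Consecutive _ _) (sym (proj₂ reversed)) (Consecutive-reverse crosses)
      }
      where
      open Via V
      reversed = HamPath-reverse path

    Route : List A → W → W → W → Set
    Route B x y w = Via B x y w (sPlus j w) ⊎ Via B x y (sPlus j w) w

    Route-reverse : ∀ {B x y w} → Route B x y w → Route B y x w
    Route-reverse (inj₁ V) = inj₂ (Via-reverse V)
    Route-reverse (inj₂ V) = inj₁ (Via-reverse V)

    -- The copies in L are covered before the edge from a to b, all copies outside B and L after it.
    via : ∀ B L {x a b y β} → PathThrough L x a → Adj a b → Arr P b → Arr P y → copy j b ≡ β →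
      Unique ((B ++ L) ++ β ∷ copy j y ∷ []) → All P (B ++ L) → Via B x y a b
    via B L {b = b} {y} p a~b ab ay refl uE pBL = record
      { copies = L ++ R
      ; path = PathThrough-++ p a~b (throughCopies D ab ay uR pD) λ (s∈L , s∈R) → BL#R (∈-++⁺ʳ B s∈L , s∈R)
      ; complement = subst (Arrangement P) (++-assoc B L R) aR
      ; crosses = Consecutive-++⟨⟩ (HamPath.walk p) a~b _
      }
      where
      D,aE = extend ab uE (All.++⁺ pBL (Arr-lookup ab (pos j) ∷ Arr-lookup ay (pos j) ∷ []))
      D = proj₁ D,aE
      R = copy j b ∷ copy j y ∷ D
      aR : Arrangement P ((B ++ L) ++ R)
      aR = subst (Arrangement P) (++-assoc (B ++ L) _ D) (proj₂ D,aE)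
      uR = proj₁ (Unique-++⁻ (B ++ L) (unique aR))
      BL#R = proj₂ (Unique-++⁻ (B ++ L) (unique aR))
      pD : All P D
      pD = All.tabulate λ s∈D → sound aR (∈-++⁺ʳ (B ++ L) (there (there s∈D)))

    module _ (B : List A) {x y w : W} (ax : Arr P x) (ay : Arr P y) (aw : Arr P w) (pB : All P B) where

      private
        X = copy j x
        Y = copy j y
        pX = Arr-lookup ax (pos j)
        reassociate : ∀ {L R} → Unique (B ++ L ++ R) → Unique ((B ++ L) ++ R)
        reassociate {L} {R} = subst Unique (sym (++-assoc B L R))

      routeOut : copy j w ≡ X → x ≢ w → Unique (B ++ X ∷ second w ∷ Y ∷ []) → Route B x y w
      routeOut w~x x≢w u = inj₁ (via B (X ∷ []) (withinCopy ax aw w~x x≢w) (sPlus-adj j w)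
        (Arr-Adj (sPlus-adj j w) aw) ay (copy-sPlus j w) (reassociate u) (All.++⁺ pB (pX ∷ [])))

      routeIn : second w ≡ X → x ≢ sPlus j w → Unique (B ++ X ∷ copy j w ∷ Y ∷ []) → Route B x y w
      routeIn second≡X x≢w⁺ u = inj₂ (via B (X ∷ [])
        (withinCopy ax (Arr-Adj (sPlus-adj j w) aw) (trans (copy-sPlus j w) second≡X) x≢w⁺)
        (Adj-sym (sPlus-adj j w)) aw ay refl (reassociate u) (All.++⁺ pB (pX ∷ [])))

      routeFresh : Unique (B ++ X ∷ copy j w ∷ second w ∷ Y ∷ []) → Route B x y w
      routeFresh u = inj₁ (via B (X ∷ copy j w ∷ [])
        (throughCopies [] ax aw (Unique.take⁺ 2 (proj₁ (Unique-++⁻ B u))) []) (sPlus-adj j w)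
        (Arr-Adj (sPlus-adj j w) aw) ay (copy-sPlus j w) (reassociate u)
        (All.++⁺ pB (pX ∷ Arr-lookup aw (pos j) ∷ [])))

    ≢sPlus : ∀ {w w′ q} → Arr P w′ → first w ≡ q → first w′ ≡ q → w ≢ sPlus j w′
    ≢sPlus {w′ = w′} aw′ w-first w′-first refl =
      Arr-distinct aw′ {zero} {pos j} (λ ()) (trans w′-first (trans (sym w-first) (first-sPlus j w′)))

    Heads : W → A → Set
    Heads x z = first x ≡ z ⊎ second x ≡ z

    Heads-≢ : ∀ {x w z} → Heads x z → first w ≢ z → second w ≢ z → x ≢ w
    Heads-≢ (inj₁ e) first≢ _ refl = first≢ e
    Heads-≢ (inj₂ e) _ second≢ refl = second≢ e

    record TwoEdges (q : A) (R : W → Set) : Set where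
      field
        w₁ w₂    : W
        arr₁     : Arr P w₁
        arr₂     : Arr P w₂
        first₁   : first w₁ ≡ q
        first₂   : first w₂ ≡ q
        distinct : w₁ ≢ w₂
        at₁      : R w₁
        at₂      : R w₂

    TwoEdges-map : ∀ {q} {R R′ : W → Set} → (∀ {w} → R w → R′ w) → TwoEdges q R → TwoEdges q R′
    TwoEdges-map f T = record
      { w₁ = w₁ ; w₂ = w₂ ; arr₁ = arr₁ ; arr₂ = arr₂ ; first₁ = first₁ ; first₂ = first₂
      ; distinct = distinct ; at₁ = f at₁ ; at₂ = f at₂ }
      where open TwoEdges T

    fromPrescribed : ∀ {q b₁ a₁ b₂ a₂} {R : W → Set}
      (p₁ : Prescribed P j q b₁ a₁) (p₂ : Prescribed P j q b₂ a₂) → b₁ ≢ b₂ ⊎ a₁ ≢ a₂ →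
      R (Prescribed.word p₁) → R (Prescribed.word p₂) → TwoEdges q R
    fromPrescribed p₁ p₂ differ r₁ r₂ = record
      { w₁ = P₁.word ; w₂ = P₂.word ; arr₁ = P₁.arr ; arr₂ = P₂.arr
      ; first₁ = P₁.first≡ ; first₂ = P₂.first≡
      ; distinct = λ w₁≡w₂ → case differ of λ
          { (inj₁ b₁≢b₂) → b₁≢b₂ (trans (sym P₁.second≡) (trans (cong second w₁≡w₂) P₂.second≡))
          ; (inj₂ a₁≢a₂) → a₁≢a₂ (trans (sym P₁.copy≡) (trans (cong (copy j) w₁≡w₂) P₂.copy≡)) }
      ; at₁ = r₁ ; at₂ = r₂ }
      where
      module P₁ = Prescribed p₁
      module P₂ = Prescribed p₂

    -- w₁ and w₂ lie in two fresh copies a ≠ b, with second symbols b and a.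
    pairFresh : ∀ {x y q} → Arr P x → Arr P y → P q → copy j x ≢ copy j y → q ≡ copy j x ⊎ q ≡ copy j y →
      TwoEdges q (Route [] x y)
    pairFresh {x} {y} {q} ax ay pq X≢Y q∈XY
      with a , pa , a∉ ← fresh ax (copy j x ∷ copy j y ∷ []) (s≤s (s≤s (s≤s z≤n)))
      with b , pb , b∉ ← fresh ax (copy j x ∷ copy j y ∷ a ∷ []) (s≤s (s≤s (s≤s (s≤s z≤n)))) =
      fromPrescribed p₁ p₂ (inj₁ b≢a) (route p₁ (distinct₄ X≢a X≢b X≢Y a≢b a≢Y b≢Y))
                                        (route p₂ (distinct₄ X≢b X≢a X≢Y b≢a b≢Y a≢Y))
      where
      X = copy j x
      Y = copy j y
      X≢a = ∉⇒≢ a∉ (here refl)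
      Y≢a = ∉⇒≢ a∉ (there (here refl))
      X≢b = ∉⇒≢ b∉ (here refl)
      Y≢b = ∉⇒≢ b∉ (there (here refl))
      a≢b = ∉⇒≢ b∉ (there (there (here refl)))
      b≢a = a≢b ∘ sym
      a≢Y = Y≢a ∘ sym
      b≢Y = Y≢b ∘ sym
      q≢ : ∀ {s} → X ≢ s → Y ≢ s → q ≢ s
      q≢ X≢s Y≢s q≡s = case q∈XY of λ
        { (inj₁ q≡X) → X≢s (trans (sym q≡X) q≡s)
        ; (inj₂ q≡Y) → Y≢s (trans (sym q≡Y) q≡s) }
      p₁ = prescribe j ax pq pb pa (q≢ X≢b Y≢b) (q≢ X≢a Y≢a) b≢a
      p₂ = prescribe j ax pq pa pb (q≢ X≢a Y≢a) (q≢ X≢b Y≢b) a≢b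
      route : ∀ {β α} (p : Prescribed P j q β α) → Unique (X ∷ α ∷ β ∷ Y ∷ []) →
        Route [] x y (Prescribed.word p)
      route p u = routeFresh [] ax ay arr []
        (subst₂ (λ α β → Unique (X ∷ α ∷ β ∷ Y ∷ [])) (sym copy≡) (sym second≡) u)
        where open Prescribed p

    -- w₁ lies in the copy of x and w₂ in the copy of y, both with second symbol f.
    pairAtEnds : ∀ B {x y q f zx zy} → Arr P x → Arr P y → P q → P f → All P B →
      Heads x zx → Heads y zy → q ≢ zx → q ≢ zy → f ≢ zx → f ≢ zy →
      q ≢ f → q ≢ copy j x → q ≢ copy j y → Unique (B ++ copy j x ∷ f ∷ copy j y ∷ []) →
      TwoEdges q (Route B x y)
    pairAtEnds B {x} {y} {q} {f} ax ay pq pf pB hx hy q≢zx q≢zy f≢zx f≢zy q≢f q≢X q≢Y u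
      with (X≢f ∷ X≢Y ∷ []) ∷ (f≢Y ∷ []) ∷ _ ← proj₁ (Unique-++⁻ B u) =
      fromPrescribed p₁ p₂ (inj₂ X≢Y)
        (routeOut B ax ay P₁.arr pB P₁.copy≡ (Heads-≢ hx (≡-≢ P₁.first≡ q≢zx) (≡-≢ P₁.second≡ f≢zx))
          (subst (λ β → Unique (B ++ X ∷ β ∷ Y ∷ [])) (sym P₁.second≡) u))
        (Route-reverse (routeOut B ay ax P₂.arr pB P₂.copy≡
          (Heads-≢ hy (≡-≢ P₂.first≡ q≢zy) (≡-≢ P₂.second≡ f≢zy))
          (subst (λ β → Unique (B ++ Y ∷ β ∷ X ∷ [])) (sym P₂.second≡) (flip₃ B u))))
      where
      X = copy j x
      Y = copy j y
      ≡-≢ : ∀ {s t z : A} → s ≡ t → t ≢ z → s ≢ z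
      ≡-≢ s≡t t≢z s≡z = t≢z (trans (sym s≡t) s≡z)
      p₁ = prescribe j ax pq pf (Arr-lookup ax (pos j)) q≢f q≢X (X≢f ∘ sym)
      p₂ = prescribe j ay pq pf (Arr-lookup ay (pos j)) q≢f q≢Y f≢Y
      module P₁ = Prescribed p₁
      module P₂ = Prescribed p₂

    -- With e fresh, w₁ lies in copy e with second symbol copy j y, w₂ in the copy of y with
    -- second symbol e.
    pairAtCopy : ∀ {c x y q} → Arr P x → Arr P y → P c → q ≡ copy j x → q ≢ c → Heads y c →
      Unique (c ∷ copy j x ∷ copy j y ∷ []) → TwoEdges q (Route (c ∷ []) x y)
    pairAtCopy {c} {x} {y} {q} ax ay pc q≡X q≢c hy u@((c≢X ∷ c≢Y ∷ []) ∷ (X≢Y ∷ []) ∷ [] ∷ [])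
      with e , pe , e∉ ← fresh ax (c ∷ copy j x ∷ copy j y ∷ []) (s≤s (s≤s (s≤s (s≤s z≤n)))) =
      fromPrescribed p₁ p₂ (inj₁ Y≢e)
        (Route-reverse (routeIn (c ∷ []) ay ax P₁.arr (pc ∷ []) P₁.second≡
          (Heads-≢ hy (λ w⁺≡c → c≢e (trans (sym w⁺≡c) (trans (first-sPlus j P₁.word) P₁.copy≡)))
                      (λ w⁺≡c → q≢c (trans (sym P₁.first≡) (trans (sym (second-sPlus j P₁.word)) w⁺≡c))))
          (subst (λ α → Unique (c ∷ Y ∷ α ∷ X ∷ [])) (sym P₁.copy≡) u′)))
        (Route-reverse (routeOut (c ∷ []) ay ax P₂.arr (pc ∷ []) P₂.copy≡
          (Heads-≢ hy (λ w≡c → q≢c (trans (sym P₂.first≡) w≡c))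
                      (λ w≡c → c≢e (trans (sym w≡c) P₂.second≡)))
          (subst (λ β → Unique (c ∷ Y ∷ β ∷ X ∷ [])) (sym P₂.second≡) u′)))
      where
      X = copy j x
      Y = copy j y
      c≢e = ∉⇒≢ e∉ (here refl)
      X≢e = ∉⇒≢ e∉ (there (here refl))
      Y≢e = ∉⇒≢ e∉ (there (there (here refl)))
      u′ : Unique (c ∷ Y ∷ e ∷ X ∷ [])
      u′ = distinct₄ c≢Y c≢e c≢X Y≢e (X≢Y ∘ sym) (X≢e ∘ sym)
      pq = subst P (sym q≡X) (Arr-lookup ax (pos j))
      q≢Y = λ q≡Y → X≢Y (trans (sym q≡X) q≡Y)
      q≢e = λ q≡e → X≢e (trans (sym q≡X) q≡e)
      p₁ = prescribe j ax pq (Arr-lookup ay (pos j)) pe q≢Y q≢e Y≢e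
      p₂ = prescribe j ax pq pe (Arr-lookup ay (pos j)) q≢e q≢Y (Y≢e ∘ sym)
      module P₁ = Prescribed p₁
      module P₂ = Prescribed p₂

    -- With e fresh, w₁ and w₂ lie in copy e, with second symbols copy j x and copy j y.
    pairAtAvoided : ∀ {c x y} → Arr P x → Arr P y → P c → first x ≡ c → first y ≡ c →
      Unique (c ∷ copy j x ∷ copy j y ∷ []) → TwoEdges c (Route (c ∷ []) x y)
    pairAtAvoided {c} {x} {y} ax ay pc x-first y-first ((c≢X ∷ c≢Y ∷ []) ∷ (X≢Y ∷ []) ∷ [] ∷ [])
      with e , pe , e∉ ← fresh ax (c ∷ copy j x ∷ copy j y ∷ []) (s≤s (s≤s (s≤s (s≤s z≤n)))) =
      fromPrescribed p₁ p₂ (inj₁ X≢Y)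
        (routeIn (c ∷ []) ax ay P₁.arr (pc ∷ []) P₁.second≡ (≢w⁺ x-first p₁)
          (subst (λ α → Unique (c ∷ X ∷ α ∷ Y ∷ [])) (sym P₁.copy≡)
            (distinct₄ c≢X c≢e c≢Y X≢e X≢Y (Y≢e ∘ sym))))
        (Route-reverse (routeIn (c ∷ []) ay ax P₂.arr (pc ∷ []) P₂.second≡ (≢w⁺ y-first p₂)
          (subst (λ α → Unique (c ∷ Y ∷ α ∷ X ∷ [])) (sym P₂.copy≡)
            (distinct₄ c≢Y c≢e c≢X Y≢e (X≢Y ∘ sym) (X≢e ∘ sym)))))
      where
      X = copy j x
      Y = copy j y
      c≢e = ∉⇒≢ e∉ (here refl)
      X≢e = ∉⇒≢ e∉ (there (here refl))
      Y≢e = ∉⇒≢ e∉ (there (there (here refl)))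
      p₁ = prescribe j ax pc (Arr-lookup ax (pos j)) pe c≢X c≢e X≢e
      p₂ = prescribe j ax pc (Arr-lookup ay (pos j)) pe c≢Y c≢e Y≢e
      module P₁ = Prescribed p₁
      module P₂ = Prescribed p₂
      ≢w⁺ : ∀ {v b} → first v ≡ c → (p : Prescribed P j c b e) → v ≢ sPlus j (Prescribed.word p)
      ≢w⁺ {v} v-first p v≡w⁺ = c≢e (begin
        c                        ≡⟨ v-first ⟨
        first v                  ≡⟨ cong first v≡w⁺ ⟩
        first (sPlus j word)     ≡⟨ first-sPlus j word ⟩
        copy j word              ≡⟨ copy≡ ⟩
        e                        ∎)
        where
        open Prescribed p
        open ≡-Reasoning

    HamPathUsing : W → W → W → Set
    HamPathUsing s t w = Σ (HamPath (Arr P) s t) λ h → UsesEdge w (vertices (HamPath.walk h))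

    Via-closed : ∀ {x y a b} → Via [] x y a b →
      Σ (HamPath (Arr P) x y) λ h → Consecutive a b (vertices (HamPath.walk h))
    Via-closed V = PathThrough-spanning complement path , crosses
      where open Via V

    Via-detour : ∀ {s t x y a b} → Arr P s → (f : FirstStep (InCopies (copy j s ∷ [])) s t) → Adj s x →
      Adj y (FirstStep.next f) → Via (copy j s ∷ []) x y a b →
      Σ (HamPath (Arr P) s t) λ h → Consecutive a b (vertices (HamPath.walk h))
    Via-detour as f s~x y~next V =
      PathThrough-spanning complement (detour as f s~x path y~next c∉) ,
      Consecutive-detour as f s~x path y~next c∉ crosses
      where
      open Via V
      c∉ = Unique[x∷xs]⇒x∉xs (unique complement)

    Route-closed : ∀ {x y w} → Route [] x y w → HamPathUsing x y w
    Route-closed (inj₁ V) = map₂ inj₁ (Via-closed V)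
    Route-closed (inj₂ V) = map₂ inj₂ (Via-closed V)

    Route-detour : ∀ {s t x y w} → Arr P s → (f : FirstStep (InCopies (copy j s ∷ [])) s t) → Adj s x →
      Adj y (FirstStep.next f) → Route (copy j s ∷ []) x y w → HamPathUsing s t w
    Route-detour as f s~x y~next (inj₁ V) = map₂ inj₁ (Via-detour as f s~x y~next V)
    Route-detour as f s~x y~next (inj₂ V) = map₂ inj₂ (Via-detour as f s~x y~next V)

    Move-crossing : ∀ {x y} → Move x y → copy j x ≢ copy j y → Heads x (copy j y) × Heads y (copy j x)
    Move-crossing {_ ∷ _ ∷ _} (inj₁ refl) X≢Y = ⊥-elim (X≢Y refl)
    Move-crossing {x} (inj₂ (inj₁ (i , refl))) X≢Y with i Fin.≟ j
    ... | yes refl = inj₁ (sym (copy-sMinus j x)) , inj₂ (second-sMinus j x)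
    ... | no i≢j = ⊥-elim (X≢Y (sym (copy-sMinus-other j x i≢j)))
    Move-crossing {x} (inj₂ (inj₂ (i , refl))) X≢Y with i Fin.≟ j
    ... | yes refl = inj₂ (sym (copy-sPlus j x)) , inj₁ (first-sPlus j x)
    ... | no i≢j = ⊥-elim (X≢Y (sym (copy-sPlus-other j x i≢j)))

    crossing : ∀ {x y} → Adj x y → copy j x ≢ copy j y → Heads x (copy j y)
    crossing (inj₁ m) X≢Y = proj₁ (Move-crossing m X≢Y)
    crossing (inj₂ m) X≢Y = proj₂ (Move-crossing m (X≢Y ∘ sym))

    twoPathsAcross : ∀ {v u q} → Arr P v → Arr P u → Adj v u → copy j v ≢ copy j u → P q →
      TwoEdges q (HamPathUsing v u)
    twoPathsAcross {v} {u} {q} av au v~u X≢Y pq with q ≟ copy j v | q ≟ copy j u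
    ... | yes q≡X | _ = TwoEdges-map Route-closed (pairFresh av au pq X≢Y (inj₁ q≡X))
    ... | no _ | yes q≡Y = TwoEdges-map Route-closed (pairFresh av au pq X≢Y (inj₂ q≡Y))
    ... | no q≢X | no q≢Y
      with f , pf , f∉ ← fresh av (copy j v ∷ copy j u ∷ q ∷ []) (s≤s (s≤s (s≤s (s≤s z≤n)))) =
      TwoEdges-map Route-closed (pairAtEnds [] av au pq pf []
        (crossing v~u X≢Y) (crossing (Adj-sym v~u) (X≢Y ∘ sym))
        q≢Y q≢X (f≢ (there (here refl))) (f≢ (here refl)) (f≢ (there (there (here refl))) ∘ sym) q≢X q≢Y
        (distinct₃ (f≢ (here refl) ∘ sym) X≢Y (f≢ (there (here refl)))))
      where
      f≢ : ∀ {t} → t ∈ copy j v ∷ copy j u ∷ q ∷ [] → f ≢ t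
      f≢ t∈ = ∉⇒≢ f∉ t∈ ∘ sym

    -- s and t lie in one copy c and f starts a Hamiltonian path of that copy from s to t;
    -- every path below leaves c right after s and re-enters it at s″ through s_j^± edges.
    module SameCopy {s t : W} (as : Arr P s) (f : FirstStep (InCopies (copy j s ∷ [])) s t) {q : A} (pq : P q) where

      open FirstStep f using (rest)

      s″ : W
      s″ = FirstStep.next f
      s~s″ : Adj s s″
      s~s″ = FirstStep.step f

      c = copy j s
      pc = Arr-lookup as (pos j)
      as″ : Arr P s″
      as″ = proj₁ (proj₁ (HamPath-head rest))
      s″-copy : copy j s″ ≡ c
      s″-copy with here e ← proj₂ (proj₁ (HamPath-head rest)) = e

      ax⁺ = Arr-Adj (sPlus-adj j s) as
      ay⁺ = Arr-Adj (sPlus-adj j s″) as″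
      ax⁻ = Arr-Adj (sMinus-adj j s) as
      ay⁻ = Arr-Adj (sMinus-adj j s″) as″

      leaveAndReturn : ∀ {x y} → Adj s x → Adj y s″ → TwoEdges q (Route (c ∷ []) x y) →
        TwoEdges q (HamPathUsing s t)
      leaveAndReturn s~x y~s″ = TwoEdges-map (Route-detour as f s~x y~s″)

      c≢ : ∀ {i} → pos j ≢ i → c ≢ lookup s i
      c≢ = Arr-distinct as
      c≢″ : ∀ {i} → pos j ≢ i → c ≢ lookup s″ i
      c≢″ j≢i c≡ = Arr-distinct as″ j≢i (trans s″-copy c≡)

      X⁺ = copy j (sPlus j s)
      Y⁺ = copy j (sPlus j s″)
      X⁻ = copy j (sMinus j s)
      Y⁻ = copy j (sMinus j s″)

      c≢X⁺ : c ≢ X⁺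
      c≢X⁺ e = c≢ (λ ()) (trans e (copy-sPlus j s))
      c≢Y⁺ : c ≢ Y⁺
      c≢Y⁺ e = c≢″ (λ ()) (trans e (copy-sPlus j s″))
      c≢X⁻ : c ≢ X⁻
      c≢X⁻ e = c≢ (λ ()) (trans e (copy-sMinus j s))
      c≢Y⁻ : c ≢ Y⁻
      c≢Y⁻ e = c≢″ (λ ()) (trans e (copy-sMinus j s″))
      X⁺≢Y⁺ : X⁺ ≢ Y⁺
      X⁺≢Y⁺ e = Adj-second-≢ s~s″ as as″ (trans (sym (copy-sPlus j s)) (trans e (copy-sPlus j s″)))
      X⁻≢Y⁻ : X⁻ ≢ Y⁻
      X⁻≢Y⁻ e = Adj-first-≢ s~s″ as as″ (trans (sym (copy-sMinus j s)) (trans e (copy-sMinus j s″)))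

      first-x⁺ : first (sPlus j s) ≡ c
      first-x⁺ = first-sPlus j s
      first-y⁺ : first (sPlus j s″) ≡ c
      first-y⁺ = trans (first-sPlus j s″) s″-copy

      viaCopy : q ≡ c → TwoEdges q (HamPathUsing s t)
      viaCopy refl = leaveAndReturn (sPlus-adj j s) (Adj-sym (sPlus-adj j s″))
        (pairAtAvoided ax⁺ ay⁺ pc first-x⁺ first-y⁺ (distinct₃ c≢X⁺ c≢Y⁺ X⁺≢Y⁺))

      viaPlus : q ≡ second s → q ≢ c → TwoEdges q (HamPathUsing s t)
      viaPlus q≡ q≢c = leaveAndReturn (sPlus-adj j s) (Adj-sym (sPlus-adj j s″))
        (pairAtCopy ax⁺ ay⁺ pc (trans q≡ (sym (copy-sPlus j s))) q≢c (inj₁ first-y⁺)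
          (distinct₃ c≢X⁺ c≢Y⁺ X⁺≢Y⁺))

      viaMinus : q ≡ first s → q ≢ c → TwoEdges q (HamPathUsing s t)
      viaMinus q≡ q≢c = leaveAndReturn (sMinus-adj j s) (Adj-sym (sMinus-adj j s″))
        (pairAtCopy ax⁻ ay⁻ pc (trans q≡ (sym (copy-sMinus j s))) q≢c
          (inj₂ (trans (second-sMinus j s″) s″-copy)) (distinct₃ c≢X⁻ c≢Y⁻ X⁻≢Y⁻))

      viaNextPlus : q ≡ second s″ → q ≢ c → TwoEdges q (HamPathUsing s t)
      viaNextPlus q≡ q≢c = leaveAndReturn (sPlus-adj j s) (Adj-sym (sPlus-adj j s″))
        (TwoEdges-map Route-reverse (pairAtCopy ay⁺ ax⁺ pc (trans q≡ (sym (copy-sPlus j s″))) q≢c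
          (inj₁ first-x⁺) (distinct₃ c≢Y⁺ c≢X⁺ (X⁺≢Y⁺ ∘ sym))))

      viaNextMinus : q ≡ first s″ → q ≢ c → first s″ ≢ second s → TwoEdges q (HamPathUsing s t)
      viaNextMinus q≡ q≢c first≢second = leaveAndReturn (sPlus-adj j s) (Adj-sym (sMinus-adj j s″))
        (TwoEdges-map Route-reverse (pairAtCopy ay⁻ ax⁺ pc (trans q≡ (sym (copy-sMinus j s″))) q≢c
          (inj₁ first-x⁺) (distinct₃ c≢Y⁻ c≢X⁺ Y⁻≢X⁺)))
        where
        Y⁻≢X⁺ : Y⁻ ≢ X⁺
        Y⁻≢X⁺ e = first≢second (trans (sym (copy-sMinus j s″)) (trans e (copy-sPlus j s)))

      viaFresh : 1 ≤ k → q ≢ c → q ≢ second s → q ≢ second s″ → TwoEdges q (HamPathUsing s t)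
      viaFresh (s≤s z≤n) q≢c q≢X q≢Y
        with e , pe , e∉ ← fresh as (c ∷ X⁺ ∷ Y⁺ ∷ q ∷ []) (s≤s (s≤s (s≤s (s≤s (s≤s z≤n))))) =
        leaveAndReturn (sPlus-adj j s) (Adj-sym (sPlus-adj j s″))
          (pairAtEnds (c ∷ []) ax⁺ ay⁺ pq pe (pc ∷ []) (inj₁ first-x⁺) (inj₁ first-y⁺) q≢c q≢c
            (e≢ (here refl)) (e≢ (here refl)) (e≢ (there (there (there (here refl)))) ∘ sym)
            (λ e → q≢X (trans e (copy-sPlus j s))) (λ e → q≢Y (trans e (copy-sPlus j s″)))
            (distinct₄ c≢X⁺ (e≢ (here refl) ∘ sym) c≢Y⁺ (e≢ (there (here refl)) ∘ sym) X⁺≢Y⁺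
              (e≢ (there (there (here refl))))))
        where
        e≢ : ∀ {t} → t ∈ c ∷ X⁺ ∷ Y⁺ ∷ q ∷ [] → e ≢ t
        e≢ t∈ = ∉⇒≢ e∉ t∈ ∘ sym

    twoPathsWithin : 1 ≤ k → ∀ {s t q} → Arr P s → Arr P t → s ≢ t → copy j s ≡ copy j t → P q →
      TwoEdges q (HamPathUsing s t)
    twoPathsWithin k≥1 {s} {t} {q} as at s≢t same pq = paths
      where
      open SameCopy as (HamPath-uncons (withinCopy as at (sym same) s≢t) s≢t) pq
      paths : TwoEdges q (HamPathUsing s t)
      paths with q ≟ c | q ≟ second s | q ≟ second s″
      ... | yes q≡c | _ | _ = viaCopy q≡c
      ... | no q≢c | yes q≡ | _ = viaPlus q≡ q≢c
      ... | no q≢c | no _ | yes q≡ = viaNextPlus q≡ q≢c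
      ... | no q≢c | no q≢X | no q≢Y = viaFresh k≥1 q≢c q≢X q≢Y

  module FourSymbols {P : A → Set} where

    open Copies (hamiltonConnected 0) (suc zero) {P}
    open Routes {0} (suc zero) {P}

    third : ∀ {v : Word 2} {q} → Arr P v → P q → q ≢ first v → q ≢ second v → q ≢ copy (suc zero) v →
      q ≡ copy zero v
    third {v} av pq q≢₀ q≢₁ q≢₃ with ∈-toList⇒lookup v (complete av pq)
    ... | 0F , e = ⊥-elim (q≢₀ (sym e))
    ... | 1F , e = ⊥-elim (q≢₁ (sym e))
    ... | 2F , e = sym e
    ... | 3F , e = ⊥-elim (q≢₃ (sym e))

    -- The prism tour from v to swap12 v starts with s_3^+; lifted into the copy of v it
    -- provides the path needed when u = swap12 v.
    headSwap : ∀ {v : Word 2} → Arr P v →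
      Σ (FirstStep (InCopies (copy (suc zero) v ∷ [])) v (swap12 v)) λ f → FirstStep.next f ≡ sPlus zero v
    headSwap {v@(a ∷ b ∷ e ∷ d ∷ [])} av =
      HamPath-uncons (HamPath-resp (λ (aw , w~d) → aw , here w~d) (λ { (aw , here w~d) → aw , w~d })
        (HamPath-insert (suc zero) (Arr-lookup av 3F) (Prism.tour (Arr-remove (suc zero) v av) 1F λ ())))
        (λ v≡ → Arr-distinct av {0F} {1F} (λ ()) (cong first v≡)) , refl

    twoPathsWithin₄ : ∀ {u v q} → Arr P u → Arr P v → Adj u v → copy (suc zero) v ≡ copy (suc zero) u → P q →
      TwoEdges q (HamPathUsing v u) ⊎ TwoEdges q (HamPathUsing u v)
    twoPathsWithin₄ {u} {v} {q} au av u~v same pq = paths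
      where
      v≢u : v ≢ u
      v≢u = Adj-≢ u~v au av ∘ sym
      module V = SameCopy av (HamPath-uncons (withinCopy av au (sym same) v≢u) v≢u) pq
      module U = SameCopy au (HamPath-uncons (withinCopy au av same (v≢u ∘ sym)) (v≢u ∘ sym)) pq
      module S = SameCopy av (proj₁ (headSwap av)) pq
      paths : TwoEdges q (HamPathUsing v u) ⊎ TwoEdges q (HamPathUsing u v)
      paths with q ≟ V.c | q ≟ second v | q ≟ first v | q ≟ second u | q ≟ first u
      ... | yes q≡c | _ | _ | _ | _ = inj₁ (V.viaCopy q≡c)
      ... | no q≢c | yes q≡ | _ | _ | _ = inj₁ (V.viaPlus q≡ q≢c)
      ... | no q≢c | no _ | yes q≡ | _ | _ = inj₁ (V.viaMinus q≡ q≢c)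
      ... | no q≢c | no _ | no _ | yes q≡ | _ = inj₂ (U.viaPlus q≡ (q≢c ∘ flip trans (sym same)))
      ... | no q≢c | no _ | no _ | no _ | yes q≡ = inj₂ (U.viaMinus q≡ (q≢c ∘ flip trans (sym same)))
      -- Now q is at position 3 of both u and v, so u = swap12 v (n = 4 leaves no fresh copy).
      ... | no q≢c | no q≢₁v | no q≢₀v | no q≢₁u | no q≢₀u =
        inj₁ (subst (λ z → TwoEdges q (HamPathUsing v z)) (sym u≡swap)
          (S.viaNextMinus (trans q≡v₂ (sym s″-first)) q≢c
            (Arr-distinct av {2F} {1F} (λ ()) ∘ trans (sym s″-first))))
        where
        s″-first : first S.s″ ≡ copy zero v
        s″-first = trans (cong first (proj₂ (headSwap av))) (first-sPlus zero v)
        q≡v₂ = third av pq q≢₀v q≢₁v q≢c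
        q≡u₂ = third au pq q≢₀u q≢₁u (q≢c ∘ flip trans (sym same))
        u≡swap : u ≡ swap12 v
        u≡swap = Adj-same-tail u~v au av λ { 0F → trans (sym q≡u₂) q≡v₂ ; 1F → sym same }

  twoPaths : ∀ k {P : A → Set} {u v : Word (suc (suc k))} {q} → Arr P u → Arr P v → Adj u v → P q →
    let open Routes (fromℕ (suc k)) {P} in TwoEdges q (HamPathUsing v u) ⊎ TwoEdges q (HamPathUsing u v)
  twoPaths k {P} {u} {v} au av u~v pq with copy (fromℕ (suc k)) v ≟ copy (fromℕ (suc k)) u
  ... | no X≢Y = inj₁ (Routes.twoPathsAcross (fromℕ (suc k)) av au (Adj-sym u~v) X≢Y pq)
  twoPaths zero au av u~v pq | yes same = FourSymbols.twoPathsWithin₄ au av u~v same pq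
  twoPaths (suc k) au av u~v pq | yes same =
    inj₁ (Routes.twoPathsWithin (fromℕ (suc (suc k))) (s≤s z≤n) av au (Adj-≢ u~v au av ∘ sym) same pq)

-- Permutations of [n]

module OnPermutations (k : ℕ) where

  open SplitStar (Fin._≟_ {N (suc k)})
  open import Data.List.Membership.DecPropositional (Fin._≟_ {N (suc k)}) using (_∈?_)

  private
    W = Str (suc k)
    j = fromℕ (suc k)
    open Routes j {U}

  -- A missing symbol would leave the n entries of v only n - 1 values.
  IsPerm-complete : ∀ {v : W} → IsPerm v → ∀ s → s ∈ toList v
  IsPerm-complete {v} uv s with s ∈? toList v
  ... | yes s∈v = s∈v
  ... | no s∉v = ⊥-elim (collision (pigeonhole ≤-refl (punchOut ∘ s≢)))
    where
    s≢ = ∉-toList⇒≢ v s∉v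
    collision : (∃₂ λ i i′ → i Fin.< i′ × punchOut (s≢ i) ≡ punchOut (s≢ i′)) → ⊥
    collision (i , i′ , i<i′ , eq) = <⇒≢ i<i′ (lookup-injective v uv (punchOut-injective (s≢ i) (s≢ i′) eq))

  IsPerm⇒Arr : ∀ {v : W} → IsPerm v → Arr U v
  IsPerm⇒Arr uv = record { unique = uv ; sound = λ _ → tt ; complete = λ {s} _ → IsPerm-complete uv s }

  toHamCycle : ∀ {s t : W} → HamPath (Arr U) s t → Adj t s → HamCycle (suc k)
  toHamCycle {s} h t~s = record
    { cyc = vertices walk
    ; distinct = simple
    ; onlyPerms = All.map unique inside
    ; covers = λ v pv → spanning (IsPerm⇒Arr pv)
    ; long = Unique-⊆⇒length-≤ three-distinct (spanning as ∷ spanning a-swap ∷ spanning a-plus ∷ [])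
    ; adjacent = cycPairs-Adj walk (All.map unique inside) t~s
    }
    where
    open HamPath h
    as = HamPath-head h
    a-swap = Arr-Adj (swap12-adj s) as
    a-plus = Arr-Adj (sPlus-adj zero s) as
    three-distinct : Unique (s ∷ swap12 s ∷ sPlus zero s ∷ [])
    three-distinct = distinct₃ (Adj-≢ (swap12-adj s) as a-swap) (Adj-≢ (sPlus-adj zero s) as a-plus)
      λ e → Arr-distinct as {suc zero} {pos zero} (λ ())
              (trans (sym (first-swap12 s)) (trans (cong first e) (first-sPlus zero s)))

  CycleThrough : W → W → W → Set
  CycleThrough u v w = Σ (HamCycle (suc k)) λ H → Contains H u v × Contains H w (sPlusLast w)

  CycleThrough-sym : ∀ {u v w} → CycleThrough u v w → CycleThrough v u w
  CycleThrough-sym (H , inj₁ uv , uses) = H , inj₂ uv , uses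
  CycleThrough-sym (H , inj₂ vu , uses) = H , inj₁ vu , uses

  closeUp : ∀ {s t w} → Adj t s → HamPathUsing s t w → CycleThrough t s w
  closeUp t~s (h , uses) = toHamCycle h t~s , inj₁ (cycPairs-closing walk) , Contains-uses uses
    where
    open HamPath h
    Contains-uses : UsesEdge _ (vertices walk) → Contains (toHamCycle h t~s) _ _
    Contains-uses (inj₁ c) = inj₁ (Consecutive⇒∈cycPairs c)
    Contains-uses (inj₂ c) = inj₂ (Consecutive⇒∈cycPairs c)

  twoCycles : ∀ {u v : W} {q} → IsPerm u → IsPerm v → Adj u v → TwoEdges q (CycleThrough u v)
  twoCycles pu pv u~v with twoPaths k (IsPerm⇒Arr pu) (IsPerm⇒Arr pv) u~v tt
  ... | inj₁ T = TwoEdges-map (closeUp u~v) T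
  ... | inj₂ T = TwoEdges-map (CycleThrough-sym ∘ closeUp (Adj-sym u~v)) T

lemma2p10 : (m : ℕ) → 1 ≤ m → (u v : Str m) → Edge u v → (q : Fin (N m)) →
    ∃ λ (w₁ : Str m) → ∃ λ (w₂ : Str m) →
      IsPerm w₁ × IsPerm w₂ × head w₁ ≡ q × head w₂ ≡ q ×
      ¬ (w₁ ≡ w₂ × sPlusLast w₁ ≡ sPlusLast w₂) ×
      ¬ (w₁ ≡ sPlusLast w₂ × sPlusLast w₁ ≡ w₂) ×
      (Σ (HamCycle m) λ H → Contains H u v × Contains H w₁ (sPlusLast w₁)) ×
      (Σ (HamCycle m) λ H → Contains H u v × Contains H w₂ (sPlusLast w₂))
lemma2p10 (suc k) (s≤s z≤n) u v (pu , pv , u~v) q =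
  w₁ , w₂ , unique arr₁ , unique arr₂ , trans (head-first w₁) first₁ , trans (head-first w₂) first₂ ,
  distinct ∘ proj₁ , ≢sPlus arr₂ first₁ first₂ ∘ proj₁ , at₁ , at₂
  where
  open SplitStar (Fin._≟_ {N (suc k)})
  open Routes (fromℕ (suc k)) {U}
  open TwoEdges (OnPermutations.twoCycles k pu pv u~v)
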